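{- For all integers $r\geq 2$ and $k\geq 4$, \begin{align*} w_r(k)\geq\;& (r-2)\,r!\left((e_r-1)\frac{(r!)^{k-3}-1}{r!-1}-(r!)^{k-4}\right)\\ &+\sum_{j=0}^{r-3}\binom{r}{j}\binom{r(k-3)+j-1}{\underbrace{k-2,\dots,k-2}_{j},\underbrace{k-3,\dots,k-3}_{r-j-1},k-4}(r-j)\left[r-j-2+w_{r-j}(3)\right]. \end{align*}
   Context: For each integer $r\geq 2$, $w_r:\mathbb{Z}_{\geq 2}^r\to\mathbb{Z}_{\geq 0}$ denotes the family of functions uniquely determined by: (i) $w_2(k_1,k_2)=0$ for $k_1,k_2\geq 2$; (ii) for $r\geq 2$ and $k_1,\dots,k_r\geq 2$, inserting a coordinate equal to $2$ at any position of $(k_1,\dots,k_r)$ gives an $(r+1)$-tuple at which $w_{r+1}$ equals $w_r(k_1,\dots,k_r)$; (iii) for $k_1,\dots,k_r\geq 3$, $w_r(k_1,\dots,k_r)=\sum_{i=1}^r w_r(k_1,\dots,k_i-1,\dots,k_r)+(r-2)$ (the $i$-th coordinate decreased by $1$). $w_r(k)$ means $w_r(k,\dots,k)$. $e_r=\sum_{n=0}^r\frac{1}{n!}$. The multinomial coefficient $\binom{n}{a_1,\dots,a_r}$ equals $\frac{n!}{a_1!\cdots a_r!}$. -}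

module Defs where

open import Data.Nat as ℕ using (ℕ; zero; suc; _+_; _*_; _∸_; _^_; _≤_)
open import Data.Nat using (_!)
open import Data.Fin using (Fin)
open import Data.Vec using (Vec; []; _∷_; insertAt; updateAt; lookup; replicate; tabulate)
import Data.Vec as Vec
open import Data.List using (List; []; _∷_; map; upTo)
open import Data.Nat.ListAction using (product)
import Data.List as List
open import Data.Integer using (ℤ; +_)
open import Data.Rational as ℚ using (ℚ; 0ℚ)
open import Relation.Binary.PropositionalEquality using (_≡_)

-- Division of a rational by a natural number, with the (irrelevant here)
-- convention x / 0 = 0.  In the theorem the denominator is always nonzero.
_÷ℕ_ : ℚ → ℕ → ℚ
x ÷ℕ zero  = 0ℚ
x ÷ℕ suc d = x ℚ.* (+ 1 ℚ./ suc d)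

ℕ→ℚ : ℕ → ℚ
ℕ→ℚ n = + n ℚ./ 1

e : ℕ → ℚ
e r = List.foldr ℚ._+_ 0ℚ (map (λ n → ℚ.1ℚ ÷ℕ (n !)) (upTo (suc r)))

-- multinomial coefficient  (n ; a₁,…,a_r) = n! / (a₁! ⋯ a_r!)
-- (exact division in ℕ whenever a₁+⋯+a_r = n; the denominator is never 0)
multinomial : ℕ → List ℕ → ℕ
multinomial n as = div (n !) (product (map _! as))
  where
  div : ℕ → ℕ → ℕ
  div m zero    = 0
  div m (suc d) = m ℕ./ suc d

Σℚ[<_] : ℕ → (ℕ → ℚ) → ℚ
Σℚ[< n ] f = List.foldr ℚ._+_ 0ℚ (map f (upTo n))

record IsW (w : (r : ℕ) → Vec ℕ r → ℕ) : Set where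
  field
    base : ∀ k₁ k₂ → 2 ≤ k₁ → 2 ≤ k₂ → w 2 (k₁ ∷ k₂ ∷ []) ≡ 0
    insert2 : ∀ r → 2 ≤ r → (ks : Vec ℕ r) → (∀ i → 2 ≤ lookup ks i) →
              (p : Fin (suc r)) → w (suc r) (insertAt ks p 2) ≡ w r ks
    rec : ∀ r → 2 ≤ r → (ks : Vec ℕ r) → (∀ i → 3 ≤ lookup ks i) →
          w r ks ≡ Vec.sum (tabulate (λ i → w r (updateAt ks i (λ x → x ∸ 1)))) + (r ∸ 2)

{-# OPTIONS --safe #-}
-- Unfold recursion (iii) from (k,…,k) downwards, deleting coordinates equal to 2 by (ii); then
-- W x = Σ_{x_i ≥ 3} W (x − e_i) + (#{i : x_i ≥ 3} − 2) at every point x ≥ 2.  The points y with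
-- coordinates in {2,3} and a single 4 are reached from (k,…,k) by multinomially many lattice
-- paths; each keeps its own constant and w at the point obtained by lowering its 4, which is
-- w_{r−j}(3,…,3) once its j twos are deleted, and grouping them by j gives the sum over j.  If
-- G x is their total contribution below x, then G ≤ W, and W − G exceeds the sum of its values
-- one step down by at least r − 2 at every point with coordinates ≥ 3 of which at least two are
-- ≥ 4.  Propagating this through the layers {c − 1, c}^r from (k,…,k) down to the fours gives a
-- linear recursion in c whose solution is the first term.
module Submission where

open import Defs

module Counting where
  open import Data.Nat as ℕ using (ℕ; zero; suc; _+_; _*_; _∸_; _^_; _≤_; _<_; z≤n; s≤s; _!; _≟_; _≤?_; _≤ᵇ_; _≡ᵇ_)
  open import Data.Nat.Properties
  open import Data.Bool using (Bool; true; false; T)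
  open import Data.Fin as Fin using (Fin; zero; suc; punchIn)
  open import Data.Fin.Properties using (punchIn-injective; punchInᵢ≢i; any?; all?)
  open import Data.Vec as Vec using (Vec)
  import Data.Vec.Properties as Vec
  open import Data.Vec.Functional using (Vector; updateAt; insertAt; removeAt; toVec; tail)
    renaming (_∷_ to _◂_)
  open import Data.Vec.Functional.Properties using (updateAt-updates; updateAt-minimal; insertAt-removeAt; removeAt-punchOut; ≗-dec)
  open import Algebra.Properties.Semiring.Sum +-*-semiring using (sum; sum-syntax; sum-cong-≗; sum-remove; sum-replicate-zero; ∑-distrib-+; *-distribʳ-sum)
  open import Algebra.Properties.CommutativeMonoid.Sum *-1-commutativeMonoid using ()
    renaming (sum to ∏; sum-remove to ∏-remove; sum-cong-≗ to ∏-cong-≗; sum-replicate-zero to ∏-replicate-1; ∑-distrib-+ to ∏-distrib-*)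
  open import Algebra.Properties.CommutativeSemigroup *-commutativeSemigroup using ()
    renaming (x∙yz≈y∙xz to x*[y*z]≡y*[x*z])
  open import Algebra.Properties.CommutativeSemigroup +-commutativeSemigroup using ()
    renaming (x∙yz≈y∙xz to x+[y+z]≡y+[x+z])
  open import Data.Product using (_,_; _×_; proj₁; proj₂)
  open import Data.Sum using (_⊎_; inj₁; inj₂)
  open import Data.Empty using (⊥-elim)
  open import Function using (_∘_)
  open import Relation.Nullary using (¬_; yes; no; does)
  open import Relation.Nullary.Decidable using (dec-true)
  open import Relation.Binary.PropositionalEquality
  open import Data.List as List using ([]; _++_) renaming (_∷_ to _∷ˡ_)
  open import Data.Nat.ListAction using (product)
  import Data.Nat.DivMod as ℕ
  open import Data.Nat.Combinatorics using (_C_; nCk+nC[k+1]≡[n+1]C[k+1]; k>n⇒nCk≡0)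
  open import Data.Nat.Tactic.RingSolver using (solve-∀)

  ∑-mono-≤ : ∀ {n} {f g : Vector ℕ n} → (∀ i → f i ≤ g i) → sum f ≤ sum g
  ∑-mono-≤ {zero}  f≤g = z≤n
  ∑-mono-≤ {suc n} f≤g = +-mono-≤ (f≤g zero) (∑-mono-≤ (f≤g ∘ suc))

  ∑-const-1 : ∀ n → ∑[ i < n ] 1 ≡ n
  ∑-const-1 zero    = refl
  ∑-const-1 (suc n) = cong suc (∑-const-1 n)

  ∑-const : ∀ n c → sum (λ (_ : Fin n) → c) ≡ n * c
  ∑-const zero    c = refl
  ∑-const (suc n) c = cong (c +_) (∑-const n c)

  ∑-≤1 : ∀ {n} {f : Vector ℕ n} → (∀ i → f i ≤ 1) → sum f ≤ n
  ∑-≤1 {n} {f} f≤1 = subst (sum f ≤_) (∑-const-1 n) (∑-mono-≤ f≤1)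

  ∑≡0⇒≡0 : ∀ {n} (f : Vector ℕ n) → sum f ≡ 0 → ∀ i → f i ≡ 0
  ∑≡0⇒≡0 f ∑≡0 zero    = m+n≡0⇒m≡0 (f zero) ∑≡0
  ∑≡0⇒≡0 f ∑≡0 (suc i) = ∑≡0⇒≡0 (tail f) (m+n≡0⇒n≡0 (f zero) ∑≡0) i

  ∑-∸ : ∀ {n} (f g : Vector ℕ n) → (∀ i → g i ≤ f i) → ∑[ i < n ] (f i ∸ g i) ≡ sum f ∸ sum g
  ∑-∸ f g g≤f = sym (begin
    sum f ∸ sum g                                      ≡⟨ cong (_∸ sum g) (sum-cong-≗ (λ i → sym (m∸n+n≡m (g≤f i)))) ⟩
    sum (λ i → f i ∸ g i + g i) ∸ sum g                ≡⟨ cong (_∸ sum g) (∑-distrib-+ (λ i → f i ∸ g i) g) ⟩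
    sum (λ i → f i ∸ g i) + sum g ∸ sum g              ≡⟨ m+n∸n≡m _ (sum g) ⟩
    sum (λ i → f i ∸ g i)                              ∎)
    where open ≡-Reasoning

  ∏-^ : ∀ {n} c (f : Vector ℕ n) → ∏ (λ i → c ^ f i) ≡ c ^ sum f
  ∏-^ {zero}  c f = refl
  ∏-^ {suc n} c f = trans (cong (c ^ f zero *_) (∏-^ c (tail f))) (sym (^-distribˡ-+-* c (f zero) _))

  𝟙 : Bool → ℕ
  𝟙 true  = 1
  𝟙 false = 0

  𝟙≤1 : ∀ b → 𝟙 b ≤ 1
  𝟙≤1 true  = ≤-refl
  𝟙≤1 false = z≤n

  𝟙-T : ∀ {b} → T b → 𝟙 b ≡ 1
  𝟙-T {true} _ = refl

  𝟙-¬T : ∀ {b} → ¬ T b → 𝟙 b ≡ 0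
  𝟙-¬T {true}  ¬t = ⊥-elim (¬t _)
  𝟙-¬T {false} _  = refl

  𝟙-≤ᵇ : ∀ {m a} → m ≤ a → 𝟙 (m ≤ᵇ a) ≡ 1
  𝟙-≤ᵇ m≤a = 𝟙-T (≤⇒≤ᵇ m≤a)

  𝟙-≡ᵇ-refl : ∀ a → 𝟙 (a ≡ᵇ a) ≡ 1
  𝟙-≡ᵇ-refl a = 𝟙-T (≡⇒≡ᵇ a a refl)

  𝟙-≡ᵇ-≢ : ∀ {a b} → a ≢ b → 𝟙 (a ≡ᵇ b) ≡ 0
  𝟙-≡ᵇ-≢ {a} {b} a≢b = 𝟙-¬T (a≢b ∘ ≡ᵇ⇒≡ a b)

  𝟙*-cong : ∀ b {u v} → (T b → u ≡ v) → 𝟙 b * u ≡ 𝟙 b * v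
  𝟙*-cong true  u≡v = cong (1 *_) (u≡v _)
  𝟙*-cong false _   = refl

  𝟙*-bound : ∀ b {u v} → (T b → u ≤ v) → 𝟙 b * u ≤ v
  𝟙*-bound true  u≤v = ≤-trans (≤-reflexive (+-identityʳ _)) (u≤v _)
  𝟙*-bound false _   = z≤n

  𝟙*-mono : ∀ b {u v} → (T b → u ≤ v) → 𝟙 b * u ≤ 𝟙 b * v
  𝟙*-mono true  u≤v = *-monoʳ-≤ 1 (u≤v _)
  𝟙*-mono false _   = z≤n

  count : ∀ {n} → (ℕ → Bool) → Vector ℕ n → ℕ
  count P x = sum (λ i → 𝟙 (P (x i)))

  count≤n : ∀ {n} P (x : Vector ℕ n) → count P x ≤ n
  count≤n P x = ∑-≤1 (λ i → 𝟙≤1 (P (x i)))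

  count-all : ∀ {n} P (x : Vector ℕ n) → (∀ i → T (P (x i))) → count P x ≡ n
  count-all {n} P x all = trans (sum-cong-≗ (λ i → 𝟙-T (all i))) (∑-const-1 n)

  count-none : ∀ {n} P (x : Vector ℕ n) → (∀ i → ¬ T (P (x i))) → count P x ≡ 0
  count-none {n} P x none = trans (sum-cong-≗ (λ i → 𝟙-¬T (none i))) (sum-replicate-zero n)

  count-mono : ∀ {n} {P Q : ℕ → Bool} (x : Vector ℕ n) → (∀ i → T (P (x i)) → T (Q (x i))) → count P x ≤ count Q x
  count-mono {P = P} {Q} x P⇒Q = ∑-mono-≤ 𝟙-mono
    where
    𝟙-mono : ∀ i → 𝟙 (P (x i)) ≤ 𝟙 (Q (x i))
    𝟙-mono i with P (x i) | P⇒Q i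
    ... | false | _   = z≤n
    ... | true  | p⇒q = ≤-reflexive (sym (𝟙-T (p⇒q _)))

  count-cong : ∀ {n} P {x y : Vector ℕ n} → (∀ i → x i ≡ y i) → count P x ≡ count P y
  count-cong P x≗y = sum-cong-≗ (λ i → cong (𝟙 ∘ P) (x≗y i))

  𝟙≤count : ∀ {n} P (x : Vector ℕ n) i → 𝟙 (P (x i)) ≤ count P x
  𝟙≤count {suc n} P x i = subst (𝟙 (P (x i)) ≤_) (sym (sum-remove {i = i} (𝟙 ∘ P ∘ x))) (m≤m+n _ _)

  count≤1-unique : ∀ {n} P (x : Vector ℕ n) → count P x ≤ 1 → ∀ {i j} → T (P (x i)) → T (P (x j)) → i ≡ j
  count≤1-unique {suc n} P x #≤1 {i} {j} Pxi Pxj with i Fin.≟ j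
  ... | yes i≡j = i≡j
  ... | no i≢j  = ⊥-elim (<⇒≱ (s≤s (s≤s z≤n)) (≤-trans two≤# #≤1))
    where
    two≤# : 2 ≤ count P x
    two≤# = begin
      1 + 1                                                ≡⟨ cong₂ _+_ (𝟙-T Pxi) (𝟙-T (subst (T ∘ P) (sym (removeAt-punchOut x i≢j)) Pxj)) ⟨
      𝟙 (P (x i)) + 𝟙 (P (removeAt x i (Fin.punchOut i≢j))) ≤⟨ +-monoʳ-≤ _ (𝟙≤count P (removeAt x i) _) ⟩
      𝟙 (P (x i)) + count P (removeAt x i)                 ≡⟨ sum-remove {i = i} (𝟙 ∘ P ∘ x) ⟨
      count P x                                            ∎
      where open ≤-Reasoning

  down : ∀ {n} → Vector ℕ n → Fin n → Vector ℕ n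
  down x i = updateAt x i (_∸ 1)

  updateAt-cong-≗ : ∀ {A : Set} {n} {x y : Vector A n} (i : Fin n) (f : A → A) →
    (∀ j → x j ≡ y j) → ∀ j → updateAt x i f j ≡ updateAt y i f j
  updateAt-cong-≗ {n = suc n} zero    f x≗y zero    = cong f (x≗y zero)
  updateAt-cong-≗ {n = suc n} zero    f x≗y (suc j) = x≗y (suc j)
  updateAt-cong-≗ {n = suc n} (suc i) f x≗y zero    = x≗y zero
  updateAt-cong-≗ {n = suc n} (suc i) f x≗y (suc j) = updateAt-cong-≗ i f (x≗y ∘ suc) j

  removeAt-updateAt : ∀ {A : Set} {n} (x : Vector A (suc n)) i f → ∀ j → removeAt (updateAt x i f) i j ≡ removeAt x i j
  removeAt-updateAt x i f j = updateAt-minimal (punchIn i j) i x (punchInᵢ≢i i j)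

  removeAt-updateAt-punchIn : ∀ {A : Set} {n} (x : Vector A (suc n)) p i f → ∀ j →
    removeAt (updateAt x (punchIn p i) f) p j ≡ updateAt (removeAt x p) i f j
  removeAt-updateAt-punchIn x p i f j with i Fin.≟ j
  ... | yes refl = trans (updateAt-updates (punchIn p i) x) (sym (updateAt-updates i (removeAt x p)))
  ... | no i≢j   = trans (updateAt-minimal (punchIn p j) (punchIn p i) x (i≢j ∘ sym ∘ punchIn-injective p j i))
                         (sym (updateAt-minimal j i (removeAt x p) (i≢j ∘ sym)))

  ∑∘updateAt : ∀ {n} (g : ℕ → ℕ) (x : Vector ℕ (suc n)) i f →
    sum (g ∘ updateAt x i f) ≡ g (f (x i)) + sum (g ∘ removeAt x i)
  ∑∘updateAt g x i f = trans (sum-remove {i = i} (g ∘ updateAt x i f))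
    (cong₂ _+_ (cong g (updateAt-updates i x)) (sum-cong-≗ (cong g ∘ removeAt-updateAt x i f)))

  ∏∘updateAt : ∀ {n} (g : ℕ → ℕ) (x : Vector ℕ (suc n)) i f →
    ∏ (g ∘ updateAt x i f) ≡ g (f (x i)) * ∏ (g ∘ removeAt x i)
  ∏∘updateAt g x i f = trans (∏-remove {i = i} (g ∘ updateAt x i f))
    (cong₂ _*_ (cong g (updateAt-updates i x)) (∏-cong-≗ (cong g ∘ removeAt-updateAt x i f)))

  ∑-down : ∀ {n} (x : Vector ℕ n) i {t} → x i ≡ suc t → sum x ≡ suc (sum (down x i))
  ∑-down {suc n} x i {t} xi≡1+t = begin
    sum x                      ≡⟨ sum-remove {i = i} x ⟩
    x i + sum (removeAt x i)   ≡⟨ cong (_+ sum (removeAt x i)) xi≡1+t ⟩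
    suc t + sum (removeAt x i) ≡⟨ cong (λ a → suc (a ∸ 1 + sum (removeAt x i))) xi≡1+t ⟨
    suc (x i ∸ 1 + sum (removeAt x i)) ≡⟨ cong suc (∑∘updateAt (λ a → a) x i (_∸ 1)) ⟨
    suc (sum (down x i))       ∎
    where open ≡-Reasoning

  ∑-down-≥1 : ∀ {n} (x : Vector ℕ n) i → 1 ≤ x i → sum x ≡ suc (sum (down x i))
  ∑-down-≥1 x i 1≤xi with x i in xi≡
  ... | suc t = ∑-down x i xi≡

  count-down : ∀ {n} P (x : Vector ℕ n) i → T (P (x i)) → ¬ T (P (x i ∸ 1)) → count P x ≡ suc (count P (down x i))
  count-down {suc n} P x i Pxi ¬Pxi-1 = begin
    count P x                                      ≡⟨ sum-remove {i = i} (𝟙 ∘ P ∘ x) ⟩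
    𝟙 (P (x i)) + count P (removeAt x i)           ≡⟨ cong (_+ count P (removeAt x i)) (𝟙-T Pxi) ⟩
    suc (count P (removeAt x i))                   ≡⟨ cong (λ a → suc (a + count P (removeAt x i))) (𝟙-¬T ¬Pxi-1) ⟨
    suc (𝟙 (P (x i ∸ 1)) + count P (removeAt x i)) ≡⟨ cong suc (∑∘updateAt (𝟙 ∘ P) x i (_∸ 1)) ⟨
    suc (count P (down x i))                       ∎
    where open ≡-Reasoning

  ∏!-down : ∀ {n} (x : Vector ℕ n) i {t} → x i ≡ suc t → ∏ (λ j → x j !) ≡ suc t * ∏ (λ j → down x i j !)
  ∏!-down {suc n} x i {t} xi≡1+t = begin
    ∏ (λ j → x j !)                              ≡⟨ ∏-remove {i = i} (λ j → x j !) ⟩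
    x i ! * ∏ (λ j → removeAt x i j !)           ≡⟨ cong (λ a → a ! * ∏ (λ j → removeAt x i j !)) xi≡1+t ⟩
    suc t * t ! * ∏ (λ j → removeAt x i j !)     ≡⟨ *-assoc (suc t) (t !) _ ⟩
    suc t * (t ! * ∏ (λ j → removeAt x i j !))   ≡⟨ cong (λ a → suc t * ((a ∸ 1) ! * ∏ (λ j → removeAt x i j !))) xi≡1+t ⟨
    suc t * ((x i ∸ 1) ! * ∏ (λ j → removeAt x i j !)) ≡⟨ cong (suc t *_) (∏∘updateAt _! x i (_∸ 1)) ⟨
    suc t * ∏ (λ j → down x i j !)               ∎
    where open ≡-Reasoning

  down≥2 : ∀ {n} (x : Vector ℕ n) i → 3 ≤ x i → (∀ j → 2 ≤ x j) → ∀ j → 2 ≤ down x i j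
  down≥2 x i 3≤xi x≥2 j with i Fin.≟ j
  ... | yes refl = subst (2 ≤_) (sym (updateAt-updates i x)) (∸-monoˡ-≤ 1 3≤xi)
  ... | no i≢j   = subst (2 ≤_) (sym (updateAt-minimal j i x (i≢j ∘ sym))) (x≥2 j)

  Vec-sum-tabulate : ∀ {n} (f : Vector ℕ n) → Vec.sum (Vec.tabulate f) ≡ sum f
  Vec-sum-tabulate {zero}  f = refl
  Vec-sum-tabulate {suc n} f = cong (f zero +_) (Vec-sum-tabulate (tail f))

  toVec-updateAt : ∀ {A : Set} {n} (x : Vector A n) i f → Vec.updateAt (toVec x) i f ≡ toVec (updateAt x i f)
  toVec-updateAt {n = suc n} x zero    f = refl
  toVec-updateAt {n = suc n} x (suc i) f = cong (x zero Vec.∷_) (toVec-updateAt (tail x) i f)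

  toVec-insertAt : ∀ {A : Set} {n} (x : Vector A n) p v → Vec.insertAt (toVec x) p v ≡ toVec (insertAt x p v)
  toVec-insertAt         x zero    v = refl
  toVec-insertAt {n = suc n} x (suc p) v = cong (x zero Vec.∷_) (toVec-insertAt (tail x) p v)

  toVec-const : ∀ {A : Set} n (a : A) → toVec (λ (_ : Fin n) → a) ≡ Vec.replicate n a
  toVec-const zero    a = refl
  toVec-const (suc n) a = cong (a Vec.∷_) (toVec-const n a)

  -- Lattice paths

  -- Counts the ways to bring d to 0 by m unit decrements; only meaningful for m = sum d.
  latticePaths : ∀ {n} → ℕ → Vector ℕ n → ℕ
  latticePaths zero    d = 1
  latticePaths (suc m) d = sum (λ i → 𝟙 (1 ≤ᵇ d i) * latticePaths m (down d i))

  latticePaths-cong : ∀ {n} m {d e : Vector ℕ n} → (∀ i → d i ≡ e i) → latticePaths m d ≡ latticePaths m e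
  latticePaths-cong zero    d≗e = refl
  latticePaths-cong (suc m) d≗e =
    sum-cong-≗ (λ i → cong₂ _*_ (cong (λ a → 𝟙 (1 ≤ᵇ a)) (d≗e i)) (latticePaths-cong m (updateAt-cong-≗ i _ d≗e)))

  latticePaths-multinomial : ∀ {n} m (d : Vector ℕ n) → sum d ≡ m → latticePaths m d * ∏ (λ i → d i !) ≡ m !
  latticePaths-multinomial {n} zero d ∑d≡0 =
    cong (1 *_) (trans (∏-cong-≗ (λ i → cong _! (∑≡0⇒≡0 d ∑d≡0 i))) (∏-replicate-1 n))
  latticePaths-multinomial (suc m) d ∑d≡1+m = begin
    latticePaths (suc m) d * Π                                 ≡⟨ *-distribʳ-sum Π (λ i → 𝟙 (1 ≤ᵇ d i) * latticePaths m (down d i)) ⟩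
    sum (λ i → 𝟙 (1 ≤ᵇ d i) * latticePaths m (down d i) * Π)    ≡⟨ sum-cong-≗ term ⟩
    sum (λ i → d i * m !)                                       ≡⟨ *-distribʳ-sum (m !) d ⟨
    sum d * m !                                                 ≡⟨ cong (_* m !) ∑d≡1+m ⟩
    suc m !                                                     ∎
    where
    open ≡-Reasoning
    Π = ∏ (λ i → d i !)
    term : ∀ i → 𝟙 (1 ≤ᵇ d i) * latticePaths m (down d i) * Π ≡ d i * m !
    term i with d i in di≡
    ... | zero  = refl
    ... | suc t = begin
      (latticePaths m (down d i) + 0) * Π                        ≡⟨ cong (_* Π) (+-identityʳ (latticePaths m (down d i))) ⟩
      latticePaths m (down d i) * Π                              ≡⟨ cong (latticePaths m (down d i) *_) (∏!-down d i di≡) ⟩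
      latticePaths m (down d i) * (suc t * ∏ (λ j → down d i j !)) ≡⟨ x*[y*z]≡y*[x*z] (latticePaths m (down d i)) (suc t) _ ⟩
      suc t * (latticePaths m (down d i) * ∏ (λ j → down d i j !)) ≡⟨ cong (suc t *_) (latticePaths-multinomial m (down d i) ∑down≡m) ⟩
      suc t * m !                                                ∎
      where
      ∑down≡m : sum (down d i) ≡ m
      ∑down≡m = suc-injective (trans (sym (∑-down d i di≡)) ∑d≡1+m)

  down-∸ : ∀ {n} (x y : Vector ℕ n) i → ∀ j → down x i j ∸ y j ≡ down (λ k → x k ∸ y k) i j
  down-∸ x y i j with i Fin.≟ j
  ... | yes refl = begin
    down x i i ∸ y i    ≡⟨ cong (_∸ y i) (updateAt-updates i x) ⟩
    x i ∸ 1 ∸ y i       ≡⟨ ∸-+-assoc (x i) 1 (y i) ⟩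
    x i ∸ (1 + y i)     ≡⟨ cong (x i ∸_) (+-comm 1 (y i)) ⟩
    x i ∸ (y i + 1)     ≡⟨ ∸-+-assoc (x i) (y i) 1 ⟨
    x i ∸ y i ∸ 1       ≡⟨ updateAt-updates i (λ k → x k ∸ y k) ⟨
    down (λ k → x k ∸ y k) i i ∎
    where open ≡-Reasoning
  ... | no i≢j = trans (cong (_∸ y j) (updateAt-minimal j i x (i≢j ∘ sym)))
                       (sym (updateAt-minimal j i (λ k → x k ∸ y k) (i≢j ∘ sym)))

  pathsBetween : ∀ {n} → Vector ℕ n → Vector ℕ n → ℕ
  pathsBetween x y with all? (λ i → y i ≤? x i)
  ... | yes _ = latticePaths (sum (λ i → x i ∸ y i)) (λ i → x i ∸ y i)
  ... | no  _ = 0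

  pathsBetween-≤ : ∀ {n} (x y : Vector ℕ n) → (∀ i → y i ≤ x i) →
    pathsBetween x y ≡ latticePaths (sum (λ i → x i ∸ y i)) (λ i → x i ∸ y i)
  pathsBetween-≤ x y y≤x with all? (λ i → y i ≤? x i)
  ... | yes _  = refl
  ... | no y≰x = ⊥-elim (y≰x y≤x)

  pathsBetween-≰ : ∀ {n} (x y : Vector ℕ n) → ¬ (∀ i → y i ≤ x i) → pathsBetween x y ≡ 0
  pathsBetween-≰ x y y≰x with all? (λ i → y i ≤? x i)
  ... | yes y≤x = ⊥-elim (y≰x y≤x)
  ... | no _    = refl

  δ : ∀ {n} → Vector ℕ n → Vector ℕ n → ℕ
  δ x y = 𝟙 (does (≗-dec _≟_ x y))

  δ-≗ : ∀ {n} {x y : Vector ℕ n} → (∀ i → x i ≡ y i) → δ x y ≡ 1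
  δ-≗ {x = x} {y} x≗y = cong 𝟙 (dec-true (≗-dec _≟_ x y) x≗y)

  ≤-down : ∀ {n} {x y : Vector ℕ n} i → y i < x i → (∀ j → y j ≤ x j) → ∀ j → y j ≤ down x i j
  ≤-down {x = x} {y} i yi<xi y≤x j with i Fin.≟ j
  ... | yes refl = subst (y i ≤_) (sym (updateAt-updates i x)) (∸-monoˡ-≤ 1 yi<xi)
  ... | no i≢j   = subst (y j ≤_) (sym (updateAt-minimal j i x (i≢j ∘ sym))) (y≤x j)

  pathsBetween-down : ∀ {n} (x y : Vector ℕ n) i → y i < x i → (∀ j → y j ≤ x j) →
    ∀ {m} → sum (λ j → x j ∸ y j) ≡ suc m → pathsBetween (down x i) y ≡ latticePaths m (down (λ j → x j ∸ y j) i)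
  pathsBetween-down x y i yi<xi y≤x {m} ∑≡1+m =
    trans (pathsBetween-≤ (down x i) y (≤-down i yi<xi y≤x))
          (trans (cong (λ s → latticePaths s _) ∑≡m) (latticePaths-cong m (down-∸ x y i)))
    where
    ∑≡m : sum (λ j → down x i j ∸ y j) ≡ m
    ∑≡m = trans (sum-cong-≗ (down-∸ x y i))
                (suc-injective (trans (sym (∑-down-≥1 (λ j → x j ∸ y j) i (m<n⇒0<n∸m yi<xi))) ∑≡1+m))

  pathsBetween-step : ∀ {n} (x y : Vector ℕ n) → (∀ i → 2 ≤ y i) →
    pathsBetween x y ≤ δ x y + sum (λ i → 𝟙 (3 ≤ᵇ x i) * pathsBetween (down x i) y)
  pathsBetween-step x y y≥2 with all? (λ i → y i ≤? x i)
  ... | no _ = z≤n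
  ... | yes y≤x with sum d in ∑d≡
    where d = λ i → x i ∸ y i
  ...   | zero  = ≤-trans (≤-reflexive (sym (δ-≗ x≗y))) (m≤m+n _ _)
    where
    x≗y : ∀ i → x i ≡ y i
    x≗y i = ≤-antisym (m∸n≡0⇒m≤n (∑≡0⇒≡0 (λ i → x i ∸ y i) ∑d≡ i)) (y≤x i)
  ...   | suc m = ≤-trans (∑-mono-≤ term) (m≤n+m _ _)
    where
    d = λ i → x i ∸ y i
    term : ∀ i → 𝟙 (1 ≤ᵇ d i) * latticePaths m (down d i) ≤ 𝟙 (3 ≤ᵇ x i) * pathsBetween (down x i) y
    term i = 𝟙*-bound (1 ≤ᵇ d i) λ 1≤ᵇd → let yi<xi = m∸n≢0⇒n<m (λ d≡0 → n≮0 (subst (1 ≤_) d≡0 (≤ᵇ⇒≤ 1 (d i) 1≤ᵇd))) in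
      ≤-reflexive (sym (trans (cong (_* pathsBetween (down x i) y) (𝟙-≤ᵇ (≤-trans (s≤s (y≥2 i)) yi<xi)))
                              (trans (*-identityˡ _) (pathsBetween-down x y i yi<xi y≤x ∑d≡))))

  -- Points with coordinates 2, 3 and 4

  data Is234 : ℕ → Set where
    two   : Is234 2
    three : Is234 3
    four  : Is234 4

  Is234⇒2≤ : ∀ {a} → Is234 a → 2 ≤ a
  Is234⇒2≤ two   = s≤s (s≤s z≤n)
  Is234⇒2≤ three = s≤s (s≤s z≤n)
  Is234⇒2≤ four  = s≤s (s≤s z≤n)

  Is234⇒≤4 : ∀ {a} → Is234 a → a ≤ 4
  Is234⇒≤4 two   = s≤s (s≤s z≤n)
  Is234⇒≤4 three = s≤s (s≤s (s≤s z≤n))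
  Is234⇒≤4 four  = ≤-refl

  Is234-4≤ᵇ : ∀ {a} → Is234 a → (4 ≤ᵇ a) ≡ (a ≡ᵇ 4)
  Is234-4≤ᵇ two   = refl
  Is234-4≤ᵇ three = refl
  Is234-4≤ᵇ four  = refl

  Is234-2or≥3 : ∀ {a} → Is234 a → 𝟙 (a ≡ᵇ 2) + 𝟙 (3 ≤ᵇ a) ≡ 1
  Is234-2or≥3 two   = refl
  Is234-2or≥3 three = refl
  Is234-2or≥3 four  = refl

  Is234-≥3 : ∀ {a} → Is234 a → 𝟙 (3 ≤ᵇ a) ≡ 𝟙 (a ≡ᵇ 3) + 𝟙 (a ≡ᵇ 4)
  Is234-≥3 two   = refl
  Is234-≥3 three = refl
  Is234-≥3 four  = refl

  Is234-∸ : ∀ {a} k → 4 ≤ k → Is234 a → (k ∸ a) + 𝟙 (a ≡ᵇ 4) ≡ (k ∸ 3) + 𝟙 (a ≡ᵇ 2)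
  Is234-∸ (suc (suc (suc (suc k)))) (s≤s (s≤s (s≤s (s≤s _)))) two   = trans (+-identityʳ (suc (suc k))) (sym (+-comm (suc k) 1))
  Is234-∸ (suc (suc (suc (suc k)))) (s≤s (s≤s (s≤s (s≤s _)))) three = refl
  Is234-∸ (suc (suc (suc (suc k)))) (s≤s (s≤s (s≤s (s≤s _)))) four  = trans (+-comm k 1) (sym (+-identityʳ (suc k)))

  Is234-^ : ∀ {a} (g : ℕ → ℕ) → Is234 a → g a ≡ g 2 ^ 𝟙 (a ≡ᵇ 2) * (g 3 ^ 𝟙 (a ≡ᵇ 3) * g 4 ^ 𝟙 (a ≡ᵇ 4))
  Is234-^ g two   = sym (trans (*-identityʳ (g 2 * 1)) (*-identityʳ (g 2)))
  Is234-^ g three = sym (trans (*-identityˡ (g 3 * 1 * 1)) (trans (*-identityʳ (g 3 * 1)) (*-identityʳ (g 3))))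
  Is234-^ g four  = sym (trans (*-identityˡ (1 * (g 4 * 1))) (trans (*-identityˡ (g 4 * 1)) (*-identityʳ (g 4))))

  lower4 : ℕ → ℕ
  lower4 4 = 3
  lower4 a = a

  lower4-≤3 : ∀ {a} → Is234 a → lower4 a ≤ 3
  lower4-≤3 two   = s≤s (s≤s z≤n)
  lower4-≤3 three = ≤-refl
  lower4-≤3 four  = ≤-refl

  lower4-23 : ∀ {a} → Is234 a → lower4 a ≡ 2 ⊎ lower4 a ≡ 3
  lower4-23 two   = inj₁ refl
  lower4-23 three = inj₂ refl
  lower4-23 four  = inj₂ refl

  Is234-3≤ᵇ-lower4 : ∀ {a} → Is234 a → (3 ≤ᵇ lower4 a) ≡ (3 ≤ᵇ a)
  Is234-3≤ᵇ-lower4 two   = refl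
  Is234-3≤ᵇ-lower4 three = refl
  Is234-3≤ᵇ-lower4 four  = refl

  lower4-≢4 : ∀ {a} → Is234 a → a ≢ 4 → lower4 a ≡ a
  lower4-≢4 two   _   = refl
  lower4-≢4 three _   = refl
  lower4-≢4 four  a≢4 = ⊥-elim (a≢4 refl)

  -- inGrid k x: every coordinate of x is 2, 3 or 4 and exactly k of them are 4; ∑Grid k n sums
  -- over these points.
  inGrid : ℕ → ∀ {n} → Vector ℕ n → Bool
  inGrid k {zero}  x = k ≡ᵇ 0
  inGrid k {suc n} x = cons k (x zero)
    where
    cons : ℕ → ℕ → Bool
    cons k       2 = inGrid k (tail x)
    cons k       3 = inGrid k (tail x)
    cons (suc k) 4 = inGrid k (tail x)
    cons _       _ = false

  ∑Grid : ℕ → ∀ n → (Vector ℕ n → ℕ) → ℕ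
  ∑Grid zero    zero    F = F (λ ())
  ∑Grid (suc k) zero    F = 0
  ∑Grid zero    (suc n) F = ∑Grid 0 n (F ∘ (2 ◂_)) + ∑Grid 0 n (F ∘ (3 ◂_))
  ∑Grid (suc k) (suc n) F = ∑Grid (suc k) n (F ∘ (2 ◂_)) + ∑Grid (suc k) n (F ∘ (3 ◂_)) + ∑Grid k n (F ∘ (4 ◂_))

  ∑Grid-cong : ∀ k n {F G : Vector ℕ n → ℕ} → (∀ y → F y ≡ G y) → ∑Grid k n F ≡ ∑Grid k n G
  ∑Grid-cong zero    zero    F≗G = F≗G _
  ∑Grid-cong (suc k) zero    F≗G = refl
  ∑Grid-cong zero    (suc n) F≗G = cong₂ _+_ (∑Grid-cong 0 n (F≗G ∘ (2 ◂_))) (∑Grid-cong 0 n (F≗G ∘ (3 ◂_)))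
  ∑Grid-cong (suc k) (suc n) F≗G =
    cong₂ _+_ (cong₂ _+_ (∑Grid-cong (suc k) n (F≗G ∘ (2 ◂_))) (∑Grid-cong (suc k) n (F≗G ∘ (3 ◂_))))
              (∑Grid-cong k n (F≗G ∘ (4 ◂_)))

  ∑Grid-mono : ∀ k n {F G : Vector ℕ n → ℕ} → (∀ y → T (inGrid k y) → F y ≤ G y) → ∑Grid k n F ≤ ∑Grid k n G
  ∑Grid-mono zero    zero    F≤G = F≤G _ _
  ∑Grid-mono (suc k) zero    F≤G = z≤n
  ∑Grid-mono zero    (suc n) F≤G = +-mono-≤ (∑Grid-mono 0 n (F≤G ∘ (2 ◂_))) (∑Grid-mono 0 n (F≤G ∘ (3 ◂_)))
  ∑Grid-mono (suc k) (suc n) F≤G =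
    +-mono-≤ (+-mono-≤ (∑Grid-mono (suc k) n (F≤G ∘ (2 ◂_))) (∑Grid-mono (suc k) n (F≤G ∘ (3 ◂_))))
             (∑Grid-mono k n (F≤G ∘ (4 ◂_)))

  ∑Grid-+ : ∀ k n (F G : Vector ℕ n → ℕ) → ∑Grid k n (λ y → F y + G y) ≡ ∑Grid k n F + ∑Grid k n G
  ∑Grid-+ zero    zero    F G = refl
  ∑Grid-+ (suc k) zero    F G = refl
  ∑Grid-+ zero    (suc n) F G =
    trans (cong₂ _+_ (∑Grid-+ 0 n (F ∘ (2 ◂_)) (G ∘ (2 ◂_))) (∑Grid-+ 0 n (F ∘ (3 ◂_)) (G ∘ (3 ◂_))))
          (interchange (∑Grid 0 n (F ∘ (2 ◂_))) (∑Grid 0 n (G ∘ (2 ◂_))) (∑Grid 0 n (F ∘ (3 ◂_))) (∑Grid 0 n (G ∘ (3 ◂_))))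
    where
    interchange : ∀ a b c d → a + b + (c + d) ≡ a + c + (b + d)
    interchange = solve-∀
  ∑Grid-+ (suc k) (suc n) F G =
    trans (cong₂ _+_ (cong₂ _+_ (∑Grid-+ (suc k) n (F ∘ (2 ◂_)) (G ∘ (2 ◂_))) (∑Grid-+ (suc k) n (F ∘ (3 ◂_)) (G ∘ (3 ◂_))))
                     (∑Grid-+ k n (F ∘ (4 ◂_)) (G ∘ (4 ◂_))))
          (interchange (∑Grid (suc k) n (F ∘ (2 ◂_))) (∑Grid (suc k) n (G ∘ (2 ◂_)))
                       (∑Grid (suc k) n (F ∘ (3 ◂_))) (∑Grid (suc k) n (G ∘ (3 ◂_)))
                       (∑Grid k n (F ∘ (4 ◂_))) (∑Grid k n (G ∘ (4 ◂_))))
    where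
    interchange : ∀ a b c d e f → a + b + (c + d) + (e + f) ≡ a + c + e + (b + d + f)
    interchange = solve-∀

  ∑Grid-*ˡ : ∀ k n c (F : Vector ℕ n → ℕ) → ∑Grid k n (λ y → c * F y) ≡ c * ∑Grid k n F
  ∑Grid-*ˡ zero    zero    c F = refl
  ∑Grid-*ˡ (suc k) zero    c F = sym (*-zeroʳ c)
  ∑Grid-*ˡ zero    (suc n) c F =
    trans (cong₂ _+_ (∑Grid-*ˡ 0 n c (F ∘ (2 ◂_))) (∑Grid-*ˡ 0 n c (F ∘ (3 ◂_)))) (sym (*-distribˡ-+ c _ _))
  ∑Grid-*ˡ (suc k) (suc n) c F =
    trans (cong₂ _+_ (cong₂ _+_ (∑Grid-*ˡ (suc k) n c (F ∘ (2 ◂_))) (∑Grid-*ˡ (suc k) n c (F ∘ (3 ◂_))))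
                     (∑Grid-*ˡ k n c (F ∘ (4 ◂_))))
          (trans (cong (_+ c * ∑Grid k n (F ∘ (4 ◂_))) (sym (*-distribˡ-+ c _ _))) (sym (*-distribˡ-+ c _ _)))

  ∑Grid-zero : ∀ k n → ∑Grid k n (λ _ → 0) ≡ 0
  ∑Grid-zero k n = ∑Grid-*ˡ k n 0 (λ _ → 0)

  ∑Grid-∑ : ∀ k n {m} (G : Fin m → Vector ℕ n → ℕ) → ∑Grid k n (λ y → sum (λ i → G i y)) ≡ sum (λ i → ∑Grid k n (G i))
  ∑Grid-∑ k n {zero}  G = ∑Grid-zero k n
  ∑Grid-∑ k n {suc m} G = trans (∑Grid-+ k n (G zero) (λ y → sum (λ i → G (suc i) y)))
                                (cong (∑Grid k n (G zero) +_) (∑Grid-∑ k n (G ∘ suc)))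

  Respects≗ : ∀ {n} → (Vector ℕ n → ℕ) → Set
  Respects≗ {n} G = ∀ {y z : Vector ℕ n} → (∀ i → y i ≡ z i) → G y ≡ G z

  ◂-respects : ∀ {n} {G : Vector ℕ (suc n) → ℕ} a → Respects≗ G → Respects≗ (G ∘ (a ◂_))
  ◂-respects a resp y≗z = resp λ { zero → refl ; (suc i) → y≗z i }

  ◂-tail : ∀ {n} (x : Vector ℕ (suc n)) {a} → x zero ≡ a → ∀ i → (a ◂ tail x) i ≡ x i
  ◂-tail x x₀≡a zero    = sym x₀≡a
  ◂-tail x x₀≡a (suc i) = refl

  ∑Grid-δ : ∀ k n (x : Vector ℕ n) (G : Vector ℕ n → ℕ) → Respects≗ G →
    ∑Grid k n (λ y → δ x y * G y) ≡ 𝟙 (inGrid k x) * G x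
  ∑Grid-δ zero    zero    x G resp = cong (1 *_) (resp (λ ()))
  ∑Grid-δ (suc k) zero    x G resp = refl
  ∑Grid-δ zero    (suc n) x G resp with x zero in x₀≡
  ... | 2 = trans (cong₂ _+_ (∑Grid-δ 0 n (tail x) (G ∘ (2 ◂_)) (◂-respects 2 resp)) (∑Grid-zero 0 n))
                  (trans (+-identityʳ _) (cong (𝟙 (inGrid 0 (tail x)) *_) (resp (◂-tail x x₀≡))))
  ... | 3 = trans (cong₂ _+_ (∑Grid-zero 0 n) (∑Grid-δ 0 n (tail x) (G ∘ (3 ◂_)) (◂-respects 3 resp)))
                  (cong (𝟙 (inGrid 0 (tail x)) *_) (resp (◂-tail x x₀≡)))
  ... | 0 = cong₂ _+_ (∑Grid-zero 0 n) (∑Grid-zero 0 n)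
  ... | 1 = cong₂ _+_ (∑Grid-zero 0 n) (∑Grid-zero 0 n)
  ... | suc (suc (suc (suc _))) = cong₂ _+_ (∑Grid-zero 0 n) (∑Grid-zero 0 n)
  ∑Grid-δ (suc k) (suc n) x G resp with x zero in x₀≡
  ... | 2 = trans (cong₂ _+_ (cong₂ _+_ (∑Grid-δ (suc k) n (tail x) (G ∘ (2 ◂_)) (◂-respects 2 resp)) (∑Grid-zero (suc k) n))
                             (∑Grid-zero k n))
                  (trans (trans (+-identityʳ _) (+-identityʳ _)) (cong (𝟙 (inGrid (suc k) (tail x)) *_) (resp (◂-tail x x₀≡))))
  ... | 3 = trans (cong₂ _+_ (cong₂ _+_ (∑Grid-zero (suc k) n) (∑Grid-δ (suc k) n (tail x) (G ∘ (3 ◂_)) (◂-respects 3 resp)))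
                             (∑Grid-zero k n))
                  (trans (+-identityʳ _) (cong (𝟙 (inGrid (suc k) (tail x)) *_) (resp (◂-tail x x₀≡))))
  ... | 4 = trans (cong₂ _+_ (cong₂ _+_ (∑Grid-zero (suc k) n) (∑Grid-zero (suc k) n))
                             (∑Grid-δ k n (tail x) (G ∘ (4 ◂_)) (◂-respects 4 resp)))
                  (cong (𝟙 (inGrid k (tail x)) *_) (resp (◂-tail x x₀≡)))
  ... | 0 = cong₂ _+_ (cong₂ _+_ (∑Grid-zero (suc k) n) (∑Grid-zero (suc k) n)) (∑Grid-zero k n)
  ... | 1 = cong₂ _+_ (cong₂ _+_ (∑Grid-zero (suc k) n) (∑Grid-zero (suc k) n)) (∑Grid-zero k n)
  ... | suc (suc (suc (suc (suc _)))) = cong₂ _+_ (cong₂ _+_ (∑Grid-zero (suc k) n) (∑Grid-zero (suc k) n)) (∑Grid-zero k n)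

  Is234-◂ : ∀ {n} (x : Vector ℕ (suc n)) {a} → x zero ≡ a → Is234 a → (∀ i → Is234 (tail x i)) → ∀ i → Is234 (x i)
  Is234-◂ x x₀≡a a∈ tail∈ zero    = subst Is234 (sym x₀≡a) a∈
  Is234-◂ x x₀≡a a∈ tail∈ (suc i) = tail∈ i

  inGrid-sound : ∀ k {n} (y : Vector ℕ n) → T (inGrid k y) → (∀ i → Is234 (y i)) × count (_≡ᵇ 4) y ≡ k
  inGrid-sound zero    {zero}  y _ = (λ ()) , refl
  inGrid-sound (suc k) {zero}  y ()
  inGrid-sound zero    {suc n} y t with y zero in y₀≡
  ... | 2 = let (∈ , #) = inGrid-sound 0 (tail y) t in Is234-◂ y y₀≡ two ∈ , #
  ... | 3 = let (∈ , #) = inGrid-sound 0 (tail y) t in Is234-◂ y y₀≡ three ∈ , #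
  ... | 0 = ⊥-elim t
  ... | 1 = ⊥-elim t
  ... | suc (suc (suc (suc _))) = ⊥-elim t
  inGrid-sound (suc k) {suc n} y t with y zero in y₀≡
  ... | 2 = let (∈ , #) = inGrid-sound (suc k) (tail y) t in Is234-◂ y y₀≡ two ∈ , #
  ... | 3 = let (∈ , #) = inGrid-sound (suc k) (tail y) t in Is234-◂ y y₀≡ three ∈ , #
  ... | 4 = let (∈ , #) = inGrid-sound k (tail y) t in Is234-◂ y y₀≡ four ∈ , cong suc #
  ... | 0 = ⊥-elim t
  ... | 1 = ⊥-elim t
  ... | suc (suc (suc (suc (suc _)))) = ⊥-elim t

  inGrid1-down-peak : ∀ {n} (x : Vector ℕ n) → T (inGrid 1 x) → ∀ {i} → x i ≡ 4 → ∀ j → down x i j ≡ lower4 (x j)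
  inGrid1-down-peak x x∈ {i} xi≡4 j with i Fin.≟ j | inGrid-sound 1 x x∈
  ... | yes refl | _ = trans (updateAt-updates i x) (trans (cong (_∸ 1) xi≡4) (cong lower4 (sym xi≡4)))
  ... | no i≢j | (coords , one4) = trans (updateAt-minimal j i x (i≢j ∘ sym)) (sym (lower4-≢4 (coords j) xj≢4))
    where
    xj≢4 : x j ≢ 4
    xj≢4 xj≡4 = i≢j (count≤1-unique (_≡ᵇ 4) x (≤-reflexive one4) (≡⇒≡ᵇ (x i) 4 xi≡4) (≡⇒≡ᵇ (x j) 4 xj≡4))

  count2 : ∀ {n} → Vector ℕ n → ℕ
  count2 = count (_≡ᵇ 2)

  module _ {n} (y : Vector ℕ n) (y∈ : T (inGrid 1 y)) where

    private
      coords = proj₁ (inGrid-sound 1 y y∈)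
      one4 = proj₂ (inGrid-sound 1 y y∈)

    grid1-count≥3 : count (3 ≤ᵇ_) y ≡ n ∸ count2 y
    grid1-count≥3 = sym (trans (cong (_∸ count2 y) (sym count2+count≥3)) (m+n∸m≡n (count2 y) _))
      where
      count2+count≥3 : count2 y + count (3 ≤ᵇ_) y ≡ n
      count2+count≥3 = trans (sym (∑-distrib-+ (λ i → 𝟙 (y i ≡ᵇ 2)) (λ i → 𝟙 (3 ≤ᵇ y i))))
                             (trans (sum-cong-≗ (Is234-2or≥3 ∘ coords)) (∑-const-1 n))

    grid1-count≥4 : count (4 ≤ᵇ_) y ≡ 1
    grid1-count≥4 = trans (sum-cong-≗ (cong 𝟙 ∘ Is234-4≤ᵇ ∘ coords)) one4

    grid1-count3 : count (_≡ᵇ 3) y ≡ n ∸ count2 y ∸ 1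
    grid1-count3 = begin
      count (_≡ᵇ 3) y                         ≡⟨ m+n∸n≡m _ 1 ⟨
      count (_≡ᵇ 3) y + 1 ∸ 1                 ≡⟨ cong (λ c → count (_≡ᵇ 3) y + c ∸ 1) one4 ⟨
      count (_≡ᵇ 3) y + count (_≡ᵇ 4) y ∸ 1   ≡⟨ cong (_∸ 1) (∑-distrib-+ (λ i → 𝟙 (y i ≡ᵇ 3)) (λ i → 𝟙 (y i ≡ᵇ 4))) ⟨
      sum (λ i → 𝟙 (y i ≡ᵇ 3) + 𝟙 (y i ≡ᵇ 4)) ∸ 1 ≡⟨ cong (_∸ 1) (sum-cong-≗ (sym ∘ Is234-≥3 ∘ coords)) ⟩
      count (3 ≤ᵇ_) y ∸ 1                     ≡⟨ cong (_∸ 1) grid1-count≥3 ⟩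
      n ∸ count2 y ∸ 1                        ∎
      where open ≡-Reasoning

    grid1-∑ : ∀ k → 4 ≤ k → sum (λ i → k ∸ y i) ≡ n * (k ∸ 3) + count2 y ∸ 1
    grid1-∑ k 4≤k = begin
      sum (λ i → k ∸ y i)                            ≡⟨ m+n∸n≡m _ 1 ⟨
      sum (λ i → k ∸ y i) + 1 ∸ 1                    ≡⟨ cong (λ c → sum (λ i → k ∸ y i) + c ∸ 1) one4 ⟨
      sum (λ i → k ∸ y i) + count (_≡ᵇ 4) y ∸ 1      ≡⟨ cong (_∸ 1) (∑-distrib-+ (λ i → k ∸ y i) (λ i → 𝟙 (y i ≡ᵇ 4))) ⟨
      sum (λ i → k ∸ y i + 𝟙 (y i ≡ᵇ 4)) ∸ 1         ≡⟨ cong (_∸ 1) (sum-cong-≗ (Is234-∸ k 4≤k ∘ coords)) ⟩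
      sum (λ i → k ∸ 3 + 𝟙 (y i ≡ᵇ 2)) ∸ 1           ≡⟨ cong (_∸ 1) (∑-distrib-+ (λ (_ : Fin n) → k ∸ 3) (λ i → 𝟙 (y i ≡ᵇ 2))) ⟩
      sum (λ (_ : Fin n) → k ∸ 3) + count2 y ∸ 1               ≡⟨ cong (λ s → s + count2 y ∸ 1) (∑-const n (k ∸ 3)) ⟩
      n * (k ∸ 3) + count2 y ∸ 1                     ∎
      where open ≡-Reasoning

    grid1-∏ : ∀ (g : ℕ → ℕ) → ∏ (g ∘ y) ≡ g 2 ^ count2 y * (g 3 ^ (n ∸ count2 y ∸ 1) * g 4 ^ 1)
    grid1-∏ g = begin
      ∏ (g ∘ y)                                  ≡⟨ ∏-cong-≗ (Is234-^ g ∘ coords) ⟩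
      ∏ (λ i → g 2 ^ 𝟙 (y i ≡ᵇ 2) * (g 3 ^ 𝟙 (y i ≡ᵇ 3) * g 4 ^ 𝟙 (y i ≡ᵇ 4)))
        ≡⟨ trans (∏-distrib-* (λ i → g 2 ^ 𝟙 (y i ≡ᵇ 2)) (λ i → g 3 ^ 𝟙 (y i ≡ᵇ 3) * g 4 ^ 𝟙 (y i ≡ᵇ 4)))
                 (cong (∏ (λ i → g 2 ^ 𝟙 (y i ≡ᵇ 2)) *_)
                       (∏-distrib-* (λ i → g 3 ^ 𝟙 (y i ≡ᵇ 3)) (λ i → g 4 ^ 𝟙 (y i ≡ᵇ 4)))) ⟩
      ∏ (λ i → g 2 ^ 𝟙 (y i ≡ᵇ 2)) * (∏ (λ i → g 3 ^ 𝟙 (y i ≡ᵇ 3)) * ∏ (λ i → g 4 ^ 𝟙 (y i ≡ᵇ 4)))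
        ≡⟨ cong₂ _*_ (∏-^ (g 2) (λ i → 𝟙 (y i ≡ᵇ 2)))
                     (cong₂ _*_ (∏-^ (g 3) (λ i → 𝟙 (y i ≡ᵇ 3))) (∏-^ (g 4) (λ i → 𝟙 (y i ≡ᵇ 4)))) ⟩
      g 2 ^ count2 y * (g 3 ^ count (_≡ᵇ 3) y * g 4 ^ count (_≡ᵇ 4) y)
        ≡⟨ cong₂ (λ a b → g 2 ^ count2 y * (g 3 ^ a * g 4 ^ b)) grid1-count3 one4 ⟩
      g 2 ^ count2 y * (g 3 ^ (n ∸ count2 y ∸ 1) * g 4 ^ 1) ∎
      where open ≡-Reasoning

  multinomial-unique : ∀ N Ls p → p * product (List.map _! Ls) ≡ N ! → multinomial N Ls ≡ p
  multinomial-unique N Ls p p*Π≡N! with product (List.map _! Ls)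
  ... | zero  = ⊥-elim (<⇒≱ (1≤n! N) (≤-reflexive (trans (sym p*Π≡N!) (*-zeroʳ p))))
  ... | suc d = trans (cong (ℕ._/ suc d) (sym p*Π≡N!)) (ℕ.m*n/n≡m p (suc d))

  product-!-replicate : ∀ j a rest → product (List.map _! (List.replicate j a ++ rest)) ≡ (a !) ^ j * product (List.map _! rest)
  product-!-replicate zero    a rest = sym (*-identityˡ _)
  product-!-replicate (suc j) a rest = trans (cong (a ! *_) (product-!-replicate j a rest)) (sym (*-assoc (a !) _ _))

  gridPaths : ℕ → ℕ → ℕ → ℕ
  gridPaths n k j = multinomial (n * (k ∸ 3) + j ∸ 1) (List.replicate j (k ∸ 2) ++ List.replicate (n ∸ j ∸ 1) (k ∸ 3) ++ (k ∸ 4 ∷ˡ []))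

  pathsBetween-grid1 : ∀ {n} k → 4 ≤ k → (y : Vector ℕ n) → T (inGrid 1 y) → pathsBetween (λ _ → k) y ≡ gridPaths n k (count2 y)
  pathsBetween-grid1 {n} k 4≤k y y∈ =
    trans (pathsBetween-≤ (λ _ → k) y (λ i → ≤-trans (Is234⇒≤4 (proj₁ (inGrid-sound 1 y y∈) i)) 4≤k))
          (sym (multinomial-unique (n * (k ∸ 3) + j ∸ 1) Ls (latticePaths (sum d) d) paths*Π≡))
    where
    d = λ i → k ∸ y i
    j = count2 y
    Ls = List.replicate j (k ∸ 2) ++ List.replicate (n ∸ j ∸ 1) (k ∸ 3) ++ (k ∸ 4 ∷ˡ [])
    Π≡ : product (List.map _! Ls) ≡ ∏ (λ i → d i !)
    Π≡ = trans (product-!-replicate j (k ∸ 2) _)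
               (trans (cong (((k ∸ 2) !) ^ j *_) (product-!-replicate (n ∸ j ∸ 1) (k ∸ 3) _))
                      (sym (grid1-∏ y y∈ (λ a → (k ∸ a) !))))
    paths*Π≡ : latticePaths (sum d) d * product (List.map _! Ls) ≡ (n * (k ∸ 3) + j ∸ 1) !
    paths*Π≡ = trans (cong (latticePaths (sum d) d *_) Π≡)
                     (trans (latticePaths-multinomial (sum d) d refl) (cong _! (grid1-∑ y y∈ k 4≤k)))

  ∑ℕ : ℕ → (ℕ → ℕ) → ℕ
  ∑ℕ zero    f = 0
  ∑ℕ (suc n) f = f 0 + ∑ℕ n (f ∘ suc)

  ∑ℕ-cong : ∀ n {f g : ℕ → ℕ} → (∀ j → f j ≡ g j) → ∑ℕ n f ≡ ∑ℕ n g
  ∑ℕ-cong zero    f≗g = refl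
  ∑ℕ-cong (suc n) f≗g = cong₂ _+_ (f≗g 0) (∑ℕ-cong n (f≗g ∘ suc))

  ∑ℕ-+ : ∀ n (f g : ℕ → ℕ) → ∑ℕ n (λ j → f j + g j) ≡ ∑ℕ n f + ∑ℕ n g
  ∑ℕ-+ zero    f g = refl
  ∑ℕ-+ (suc n) f g = trans (cong (f 0 + g 0 +_) (∑ℕ-+ n (f ∘ suc) (g ∘ suc)))
                           (interchange (f 0) (g 0) (∑ℕ n (f ∘ suc)) (∑ℕ n (g ∘ suc)))
    where
    interchange : ∀ a b c d → a + b + (c + d) ≡ a + c + (b + d)
    interchange = solve-∀

  ∑ℕ-snoc : ∀ n (f : ℕ → ℕ) → ∑ℕ (suc n) f ≡ ∑ℕ n f + f n
  ∑ℕ-snoc zero    f = +-identityʳ (f 0)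
  ∑ℕ-snoc (suc n) f = trans (cong (f 0 +_) (∑ℕ-snoc n (f ∘ suc))) (sym (+-assoc (f 0) _ _))

  ∑ℕ-mono-prefix : ∀ {m n} (f g : ℕ → ℕ) → m ≤ n → (∀ j → j < m → f j ≤ g j) → ∑ℕ m f ≤ ∑ℕ n g
  ∑ℕ-mono-prefix {zero}  f g _ _ = z≤n
  ∑ℕ-mono-prefix {suc m} {suc n} f g (s≤s m≤n) f≤g =
    +-mono-≤ (f≤g 0 (s≤s z≤n)) (∑ℕ-mono-prefix (f ∘ suc) (g ∘ suc) m≤n (λ j j<m → f≤g (suc j) (s≤s j<m)))

  ∑ℕ-pascal : ∀ n (f : ℕ → ℕ) →
    ∑ℕ (suc (suc n)) (λ j → (suc n C j) * f j) ≡ ∑ℕ (suc n) (λ j → (n C j) * f (suc j)) + ∑ℕ (suc n) (λ j → (n C j) * f j)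
  ∑ℕ-pascal n f = begin
    1 * f 0 + ∑ℕ (suc n) (λ j → (suc n C suc j) * f (suc j))
      ≡⟨ cong (1 * f 0 +_) (∑ℕ-cong (suc n) pascal) ⟩
    1 * f 0 + ∑ℕ (suc n) (λ j → (n C j) * f (suc j) + (n C suc j) * f (suc j))
      ≡⟨ cong (1 * f 0 +_) (∑ℕ-+ (suc n) (λ j → (n C j) * f (suc j)) (λ j → (n C suc j) * f (suc j))) ⟩
    1 * f 0 + (A + ∑ℕ (suc n) (λ j → (n C suc j) * f (suc j)))
      ≡⟨ x+[y+z]≡y+[x+z] (1 * f 0) A _ ⟩
    A + ∑ℕ (suc (suc n)) (λ j → (n C j) * f j)
      ≡⟨ cong (A +_) (∑ℕ-snoc (suc n) (λ j → (n C j) * f j)) ⟩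
    A + (∑ℕ (suc n) (λ j → (n C j) * f j) + (n C suc n) * f (suc n))
      ≡⟨ cong (λ c → A + (∑ℕ (suc n) (λ j → (n C j) * f j) + c * f (suc n))) (k>n⇒nCk≡0 (n<1+n n)) ⟩
    A + (∑ℕ (suc n) (λ j → (n C j) * f j) + 0)
      ≡⟨ cong (A +_) (+-identityʳ _) ⟩
    A + ∑ℕ (suc n) (λ j → (n C j) * f j) ∎
    where
    open ≡-Reasoning
    A = ∑ℕ (suc n) (λ j → (n C j) * f (suc j))
    pascal : ∀ j → (suc n C suc j) * f (suc j) ≡ (n C j) * f (suc j) + (n C suc j) * f (suc j)
    pascal j = trans (cong (_* f (suc j)) (sym (nCk+nC[k+1]≡[n+1]C[k+1] n j))) (*-distribʳ-+ (f (suc j)) (n C j) _)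

  ∑Grid-0-count2 : ∀ n (g : ℕ → ℕ) → ∑Grid 0 n (g ∘ count2) ≡ ∑ℕ (suc n) (λ j → (n C j) * g j)
  ∑Grid-0-count2 zero    g = sym (trans (+-identityʳ (1 * g 0)) (*-identityˡ (g 0)))
  ∑Grid-0-count2 (suc n) g = trans (cong₂ _+_ (∑Grid-0-count2 n (g ∘ suc)) (∑Grid-0-count2 n g)) (sym (∑ℕ-pascal n g))

  ∑Grid-1-count2 : ∀ n (g : ℕ → ℕ) → ∑Grid 1 n (g ∘ count2) ≡ ∑ℕ (suc n) (λ j → (n C j) * (n ∸ j) * g j)
  ∑Grid-1-count2 zero    g = refl
  ∑Grid-1-count2 (suc n) g = begin
    ∑Grid 1 n (g ∘ suc ∘ count2) + ∑Grid 1 n (g ∘ count2) + ∑Grid 0 n (g ∘ count2)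
      ≡⟨ cong₂ _+_ (cong₂ _+_ (∑Grid-1-count2 n (g ∘ suc)) (∑Grid-1-count2 n g)) (∑Grid-0-count2 n g) ⟩
    ∑ℕ (suc n) (λ j → (n C j) * (n ∸ j) * g (suc j)) + ∑ℕ (suc n) (λ j → (n C j) * (n ∸ j) * g j)
      + ∑ℕ (suc n) (λ j → (n C j) * g j)
      ≡⟨ +-assoc (∑ℕ (suc n) (λ j → (n C j) * (n ∸ j) * g (suc j))) _ _ ⟩
    ∑ℕ (suc n) (λ j → (n C j) * (n ∸ j) * g (suc j))
      + (∑ℕ (suc n) (λ j → (n C j) * (n ∸ j) * g j) + ∑ℕ (suc n) (λ j → (n C j) * g j))
      ≡⟨ cong₂ _+_ (∑ℕ-cong (suc n) (λ j → *-assoc (n C j) (n ∸ j) (g (suc j))))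
                   (trans (sym (∑ℕ-+ (suc n) (λ j → (n C j) * (n ∸ j) * g j) (λ j → (n C j) * g j)))
                          (∑ℕ-cong (suc n) coefficient)) ⟩
    ∑ℕ (suc n) (λ j → (n C j) * φ (suc j)) + ∑ℕ (suc n) (λ j → (n C j) * φ j)
      ≡⟨ ∑ℕ-pascal n φ ⟨
    ∑ℕ (suc (suc n)) (λ j → (suc n C j) * φ j)
      ≡⟨ ∑ℕ-cong (suc (suc n)) (λ j → sym (*-assoc (suc n C j) (suc n ∸ j) (g j))) ⟩
    ∑ℕ (suc (suc n)) (λ j → (suc n C j) * (suc n ∸ j) * g j) ∎
    where
    open ≡-Reasoning
    φ : ℕ → ℕ
    φ j = (suc n ∸ j) * g j
    coefficient : ∀ j → (n C j) * (n ∸ j) * g j + (n C j) * g j ≡ (n C j) * φ j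
    coefficient j with j ≤? n
    ... | yes j≤n = begin
      (n C j) * (n ∸ j) * g j + (n C j) * g j   ≡⟨ cong (_+ (n C j) * g j) (*-assoc (n C j) (n ∸ j) (g j)) ⟩
      (n C j) * ((n ∸ j) * g j) + (n C j) * g j ≡⟨ *-distribˡ-+ (n C j) _ _ ⟨
      (n C j) * ((n ∸ j) * g j + g j)           ≡⟨ cong ((n C j) *_) (+-comm _ (g j)) ⟩
      (n C j) * ((1 + (n ∸ j)) * g j)           ≡⟨ cong (λ a → (n C j) * (a * g j)) (+-∸-assoc 1 j≤n) ⟨
      (n C j) * φ j                             ∎
    ... | no j≰n rewrite k>n⇒nCk≡0 (≰⇒> j≰n) = refl

  -- The staircase

  -- H n = n! (e_n − 1)
  H : ℕ → ℕ
  H zero    = 0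
  H (suc n) = suc n * H n + 1

  module _ (r a : ℕ) where

    -- On a layer {t, t + 1}^r, climb m s n bounds the points with m + n coordinates t + 1, given
    -- the bound s for those with m.
    climb : ℕ → ℕ → ℕ → ℕ
    climb m s zero    = s
    climb m s (suc n) = (m + suc n) * climb m s n + a

    -- The layer of fours starts from one 4 with bound 0: a point with a single 4 lies in the grid,
    -- so its contribution belongs to the grid part and not to the staircase.
    staircase : ℕ → ℕ
    staircase zero    = climb 1 0 (r ∸ 1)
    staircase (suc u) = climb 0 (staircase u) r

  climb-0 : ∀ r a s n → climb r a 0 s n ≡ n ! * s + a * H n
  climb-0 r a s zero    = sym (trans (cong₂ _+_ (+-identityʳ s) (*-zeroʳ a)) (+-identityʳ s))
  climb-0 r a s (suc n) = trans (cong (λ c → suc n * c + a) (climb-0 r a s n)) (rearrange (suc n) (n !) s a (H n))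
    where
    rearrange : ∀ m f s a h → m * (f * s + a * h) + a ≡ m * f * s + a * (m * h + 1)
    rearrange = solve-∀

  climb-1-0 : ∀ r a n → climb r a 1 0 n + a * suc n ! ≡ a * H (suc n)
  climb-1-0 r a zero    = refl
  climb-1-0 r a (suc n) = begin
    m * c + a + a * (m * suc n !) ≡⟨ rearrange m c a (suc n !) ⟩
    m * (c + a * suc n !) + a     ≡⟨ cong (λ z → m * z + a) (climb-1-0 r a n) ⟩
    m * (a * H (suc n)) + a       ≡⟨ rearrange′ m a (H (suc n)) ⟩
    a * (m * H (suc n) + 1)       ∎
    where
    open ≡-Reasoning
    m = suc (suc n)
    c = climb r a 1 0 n
    rearrange : ∀ m c a f → m * c + a + a * (m * f) ≡ m * (c + a * f) + a
    rearrange = solve-∀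
    rearrange′ : ∀ m a h → m * (a * h) + a ≡ a * (m * h + 1)
    rearrange′ = solve-∀

  geom : ℕ → ℕ → ℕ
  geom N zero    = 0
  geom N (suc m) = 1 + N * geom N m

  ^≡geom : ∀ N m → 1 ≤ N → N ^ m ≡ (N ∸ 1) * geom N m + 1
  ^≡geom N zero    _   = sym (cong (_+ 1) (*-zeroʳ (N ∸ 1)))
  ^≡geom N (suc m) 1≤N = begin
    N * N ^ m                           ≡⟨ cong (N *_) (^≡geom N m 1≤N) ⟩
    N * ((N ∸ 1) * geom N m + 1)        ≡⟨ cong (λ z → z * ((N ∸ 1) * geom N m + 1)) N≡ ⟨
    (N ∸ 1 + 1) * ((N ∸ 1) * geom N m + 1) ≡⟨ rearrange (N ∸ 1) (geom N m) ⟩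
    (N ∸ 1) * (1 + (N ∸ 1 + 1) * geom N m) + 1 ≡⟨ cong (λ z → (N ∸ 1) * (1 + z * geom N m) + 1) N≡ ⟩
    (N ∸ 1) * (1 + N * geom N m) + 1    ∎
    where
    open ≡-Reasoning
    N≡ : N ∸ 1 + 1 ≡ N
    N≡ = m∸n+n≡m 1≤N
    rearrange : ∀ d g → (d + 1) * (d * g + 1) ≡ d * (1 + (d + 1) * g) + 1
    rearrange = solve-∀

  staircase-closed : ∀ r a u → 1 ≤ r → staircase r a u + a * (r !) ^ suc u ≡ a * H r * geom (r !) (suc u)
  staircase-closed (suc r) a zero _ = trans (cong (climb (suc r) a 1 0 r +_) (cong (a *_) (*-identityʳ (suc r !))))
    (trans (climb-1-0 (suc r) a r) (sym (trans (cong (a * H (suc r) *_) (cong suc (*-zeroʳ (suc r !)))) (*-identityʳ _))))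
  staircase-closed r a (suc u) 1≤r = begin
    climb r a 0 s r + a * (N * N ^ suc u)   ≡⟨ cong (_+ a * (N * N ^ suc u)) (climb-0 r a s r) ⟩
    N * s + a * H r + a * (N * N ^ suc u)   ≡⟨ rearrange N s a (H r) (N ^ suc u) ⟩
    N * (s + a * N ^ suc u) + a * H r       ≡⟨ cong (λ z → N * z + a * H r) (staircase-closed r a u 1≤r) ⟩
    N * (a * H r * geom N (suc u)) + a * H r ≡⟨ rearrange′ N a (H r) (geom N (suc u)) ⟩
    a * H r * (1 + N * geom N (suc u))      ∎
    where
    open ≡-Reasoning
    N = r !
    s = staircase r a u
    rearrange : ∀ n s a h p → n * s + a * h + a * (n * p) ≡ n * (s + a * p) + a * h
    rearrange = solve-∀
    rearrange′ : ∀ n a h g → n * (a * h * g) + a * h ≡ a * h * (1 + n * g)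
    rearrange′ = solve-∀

  Layer : ∀ {n} → ℕ → Vector ℕ n → Set
  Layer t x = ∀ i → x i ≡ t ⊎ x i ≡ suc t

  tops : ∀ {n} → ℕ → Vector ℕ n → ℕ
  tops t = count (_≡ᵇ suc t)

  Layer-≥ : ∀ {n t c} {x : Vector ℕ n} → c ≤ t → Layer t x → ∀ i → c ≤ x i
  Layer-≥ {t = t} c≤t x∈ i with x∈ i
  ... | inj₁ xi≡t   = subst (_ ≤_) (sym xi≡t) c≤t
  ... | inj₂ xi≡1+t = subst (_ ≤_) (sym xi≡1+t) (≤-trans c≤t (n≤1+n t))

  Layer-down : ∀ {n t} {x : Vector ℕ n} → Layer t x → ∀ {i} → x i ≡ suc t → Layer t (down x i)
  Layer-down {x = x} x∈ {i} xi≡1+t j with i Fin.≟ j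
  ... | yes refl = inj₁ (trans (updateAt-updates i x) (cong (_∸ 1) xi≡1+t))
  ... | no i≢j   = subst (λ b → b ≡ _ ⊎ b ≡ _) (sym (updateAt-minimal j i x (i≢j ∘ sym))) (x∈ j)

  tops-down : ∀ {n t} (x : Vector ℕ n) i → x i ≡ suc t → tops t x ≡ suc (tops t (down x i))
  tops-down {t = t} x i xi≡1+t = count-down (_≡ᵇ suc t) x i
    (subst (λ b → T (b ≡ᵇ suc t)) (sym xi≡1+t) (≡⇒≡ᵇ (suc t) (suc t) refl))
    (λ top → 1+n≢n (sym (≡ᵇ⇒≡ t (suc t) (subst (λ b → T (b ∸ 1 ≡ᵇ suc t)) xi≡1+t top))))

  tops≤count≥4 : ∀ {n t} (x : Vector ℕ n) → 3 ≤ t → tops t x ≤ count (4 ≤ᵇ_) x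
  tops≤count≥4 {t = t} x 3≤t = count-mono {P = _≡ᵇ suc t} {Q = 4 ≤ᵇ_} x (λ i top → ≤⇒≤ᵇ (subst (4 ≤_) (sym (≡ᵇ⇒≡ (x i) (suc t) top)) (s≤s 3≤t)))

  Layer-bottom : ∀ {n t} {x : Vector ℕ n} → Layer t x → tops t x ≡ 0 → ∀ i → x i ≡ t
  Layer-bottom {t = t} {x} x∈ no-tops i with x∈ i
  ... | inj₁ xi≡t   = xi≡t
  ... | inj₂ xi≡1+t = ⊥-elim (1+n≢0 (trans (sym (trans (cong (λ b → 𝟙 (b ≡ᵇ suc t)) xi≡1+t) (𝟙-≡ᵇ-refl (suc t))))
                                            (∑≡0⇒≡0 (λ j → 𝟙 (x j ≡ᵇ suc t)) no-tops i)))

  tops-const : ∀ {n t} {x : Vector ℕ n} → (∀ i → x i ≡ suc t) → tops t x ≡ n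
  tops-const {t = t} {x} x≡ = count-all (_≡ᵇ suc t) x (λ i → ≡⇒≡ᵇ (x i) (suc t) (x≡ i))

  module StaircaseBound {r} (2≤r : 2 ≤ r) (a : ℕ) (D : Vector ℕ r → ℕ)
    (super : ∀ x → (∀ i → 3 ≤ x i) → 2 ≤ count (4 ≤ᵇ_) x → sum (λ i → D (down x i)) + a ≤ D x) where

    layer-bound : ∀ t m s → 3 ≤ t → 4 ≤ t ⊎ 1 ≤ m → (∀ x → Layer t x → tops t x ≡ m → s ≤ D x) →
      ∀ n x → Layer t x → tops t x ≡ m + n → climb r a m s n ≤ D x
    layer-bound t m s 3≤t wide seed zero    x x∈ #≡ = seed x x∈ (trans #≡ (+-identityʳ m))
    layer-bound t m s 3≤t wide seed (suc n) x x∈ #≡ = begin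
      (m + suc n) * K + a                  ≡⟨ cong (λ c → c * K + a) #≡ ⟨
      tops t x * K + a                     ≡⟨ cong (_+ a) (*-distribʳ-sum K (λ i → 𝟙 (x i ≡ᵇ suc t))) ⟩
      sum (λ i → 𝟙 (x i ≡ᵇ suc t) * K) + a ≤⟨ +-monoˡ-≤ a (∑-mono-≤ child) ⟩
      sum (λ i → D (down x i)) + a         ≤⟨ super x (Layer-≥ 3≤t x∈) (2≤#4 wide) ⟩
      D x                                  ∎
      where
      open ≤-Reasoning
      K = climb r a m s n
      2≤#4 : 4 ≤ t ⊎ 1 ≤ m → 2 ≤ count (4 ≤ᵇ_) x
      2≤#4 (inj₁ 4≤t) = subst (2 ≤_) (sym (count-all (4 ≤ᵇ_) x (≤⇒≤ᵇ ∘ Layer-≥ 4≤t x∈))) 2≤r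
      2≤#4 (inj₂ 1≤m) = ≤-trans (subst (2 ≤_) (sym #≡) (+-mono-≤ 1≤m (s≤s z≤n))) (tops≤count≥4 x 3≤t)
      child : ∀ i → 𝟙 (x i ≡ᵇ suc t) * K ≤ D (down x i)
      child i = 𝟙*-bound (x i ≡ᵇ suc t) (λ top → let xi≡1+t = ≡ᵇ⇒≡ (x i) (suc t) top in
        layer-bound t m s 3≤t wide seed n (down x i) (Layer-down x∈ xi≡1+t)
                    (suc-injective (trans (sym (tops-down x i xi≡1+t)) (trans #≡ (+-suc m n)))))

    staircase-bound : ∀ u x → (∀ i → x i ≡ 4 + u) → staircase r a u ≤ D x
    staircase-bound zero x x≡4 =
      layer-bound 3 1 0 ≤-refl (inj₂ ≤-refl) (λ _ _ _ → z≤n) (r ∸ 1) x (inj₂ ∘ x≡4)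
        (trans (tops-const x≡4) (sym (m+[n∸m]≡n (≤-trans (s≤s z≤n) 2≤r))))
    staircase-bound (suc u) x x≡5+u =
      layer-bound (4 + u) 0 (staircase r a u) (≤-trans (n≤1+n 3) (m≤m+n 4 u)) (inj₁ (m≤m+n 4 u))
        (λ y y∈ no-tops → staircase-bound u y (Layer-bottom y∈ no-tops)) r x (inj₂ ∘ x≡5+u) (tops-const x≡5+u)

  -- The recursion of w

  module WithRecursion (w : (r : ℕ) → Vec ℕ r → ℕ) (isW : IsW w) where
    open IsW isW

    W : ∀ n → Vector ℕ n → ℕ
    W n x = w n (toVec x)

    W-cong : ∀ n {x y : Vector ℕ n} → (∀ i → x i ≡ y i) → W n x ≡ W n y
    W-cong n x≗y = cong (w n) (Vec.tabulate-cong x≗y)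

    W-rec : ∀ {n} → 2 ≤ n → (x : Vector ℕ n) → (∀ i → 3 ≤ x i) → W n x ≡ sum (λ i → W n (down x i)) + (n ∸ 2)
    W-rec {n} 2≤n x x≥3 = trans (rec n 2≤n (toVec x) (λ i → subst (3 ≤_) (sym (Vec.lookup∘tabulate x i)) (x≥3 i)))
      (cong (_+ (n ∸ 2)) (trans (cong Vec.sum (Vec.tabulate-cong (λ i → cong (w n) (toVec-updateAt x i (_∸ 1)))))
                                (Vec-sum-tabulate (λ i → W n (down x i)))))

    W-removeAt-2 : ∀ {n} → 2 ≤ n → (x : Vector ℕ (suc n)) → (∀ i → 2 ≤ x i) → ∀ p → x p ≡ 2 →
      W (suc n) x ≡ W n (removeAt x p)
    W-removeAt-2 {n} 2≤n x x≥2 p xp≡2 = begin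
      w (suc n) (toVec x)                               ≡⟨ W-cong (suc n) x≗ ⟨
      w (suc n) (toVec (insertAt (removeAt x p) p 2))   ≡⟨ cong (w (suc n)) (toVec-insertAt (removeAt x p) p 2) ⟨
      w (suc n) (Vec.insertAt (toVec (removeAt x p)) p 2) ≡⟨ insert2 n 2≤n (toVec (removeAt x p)) removed≥2 p ⟩
      W n (removeAt x p)                                ∎
      where
      open ≡-Reasoning
      x≗ : ∀ j → insertAt (removeAt x p) p 2 j ≡ x j
      x≗ j = trans (cong (λ a → insertAt (removeAt x p) p a j) (sym xp≡2)) (insertAt-removeAt x p j)
      removed≥2 : ∀ i → 2 ≤ Vec.lookup (toVec (removeAt x p)) i
      removed≥2 i = subst (2 ≤_) (sym (Vec.lookup∘tabulate (removeAt x p) i)) (x≥2 (punchIn p i))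

    W-step : ∀ n → 2 ≤ n → (x : Vector ℕ n) → (∀ i → 2 ≤ x i) →
      W n x ≡ sum (λ i → 𝟙 (3 ≤ᵇ x i) * W n (down x i)) + (count (3 ≤ᵇ_) x ∸ 2)
    W-step n 2≤n x x≥2 with any? (λ i → x i ≟ 2)
    W-step zero () x x≥2 | _
    W-step (suc zero) (s≤s ()) x x≥2 | _
    W-step 2 _ x x≥2 | _ = trans (base (x zero) (x (suc zero)) (x≥2 zero) (x≥2 (suc zero)))
      (sym (cong₂ _+_ (trans (sum-cong-≗ term≡0) (sum-replicate-zero 2)) (m≤n⇒m∸n≡0 (count≤n (3 ≤ᵇ_) x))))
      where
      term≡0 : ∀ i → 𝟙 (3 ≤ᵇ x i) * W 2 (down x i) ≡ 0
      term≡0 i = trans (𝟙*-cong (3 ≤ᵇ x i) (λ t → let d≥2 = down≥2 x i (≤ᵇ⇒≤ 3 (x i) t) x≥2 in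
                                                     base _ _ (d≥2 zero) (d≥2 (suc zero))))
                       (*-zeroʳ (𝟙 (3 ≤ᵇ x i)))
    W-step (suc (suc (suc m))) 2≤n x x≥2 | no no2 = trans (W-rec 2≤n x x≥3)
      (cong₂ _+_ (sum-cong-≗ (λ i → sym (trans (cong (_* W _ (down x i)) (𝟙-≤ᵇ (x≥3 i))) (*-identityˡ _))))
                 (cong (_∸ 2) (sym (count-all (3 ≤ᵇ_) x (≤⇒≤ᵇ ∘ x≥3)))))
      where
      x≥3 : ∀ i → 3 ≤ x i
      x≥3 i = ≤∧≢⇒< (x≥2 i) (λ 2≡xi → no2 (i , sym 2≡xi))
    W-step (suc (suc (suc m))) _ x x≥2 | yes (p , xp≡2) = begin
      W n x                                                        ≡⟨ W-removeAt-2 (s≤s (s≤s z≤n)) x x≥2 p xp≡2 ⟩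
      W (suc (suc m)) x′                                            ≡⟨ W-step (suc (suc m)) (s≤s (s≤s z≤n)) x′ (x≥2 ∘ punchIn p) ⟩
      sum (λ i → 𝟙 (3 ≤ᵇ x′ i) * W _ (down x′ i)) + (count (3 ≤ᵇ_) x′ ∸ 2)
        ≡⟨ cong₂ _+_ (sum-cong-≗ (λ i → 𝟙*-cong (3 ≤ᵇ x′ i) (λ t → sym (W-down-removeAt i (≤ᵇ⇒≤ 3 (x′ i) t)))))
                     (cong (_∸ 2) (sym count≡)) ⟩
      sum (λ i → 𝟙 (3 ≤ᵇ x′ i) * W n (down x (punchIn p i))) + (count (3 ≤ᵇ_) x ∸ 2)
        ≡⟨ cong (λ a → 𝟙 (3 ≤ᵇ a) * W n (down x p) + sum (λ i → 𝟙 (3 ≤ᵇ x′ i) * W n (down x (punchIn p i)))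
                       + (count (3 ≤ᵇ_) x ∸ 2)) xp≡2 ⟨
      𝟙 (3 ≤ᵇ x p) * W n (down x p) + sum (λ i → 𝟙 (3 ≤ᵇ x′ i) * W n (down x (punchIn p i))) + (count (3 ≤ᵇ_) x ∸ 2)
        ≡⟨ cong (_+ (count (3 ≤ᵇ_) x ∸ 2)) (sum-remove {i = p} (λ i → 𝟙 (3 ≤ᵇ x i) * W n (down x i))) ⟨
      sum (λ i → 𝟙 (3 ≤ᵇ x i) * W n (down x i)) + (count (3 ≤ᵇ_) x ∸ 2) ∎
      where
      open ≡-Reasoning
      n = suc (suc (suc m))
      x′ = removeAt x p
      W-down-removeAt : ∀ i → 3 ≤ x′ i → W n (down x (punchIn p i)) ≡ W (suc (suc m)) (down x′ i)
      W-down-removeAt i 3≤x′i =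
        trans (W-removeAt-2 (s≤s (s≤s z≤n)) (down x (punchIn p i)) (down≥2 x (punchIn p i) 3≤x′i x≥2) p
                            (trans (updateAt-minimal p (punchIn p i) x (punchInᵢ≢i p i ∘ sym)) xp≡2))
              (W-cong _ (removeAt-updateAt-punchIn x p i (_∸ 1)))
      count≡ : count (3 ≤ᵇ_) x ≡ count (3 ≤ᵇ_) x′
      count≡ = trans (sum-remove {i = p} (𝟙 ∘ (3 ≤ᵇ_) ∘ x)) (cong (λ a → 𝟙 (3 ≤ᵇ a) + count (3 ≤ᵇ_) x′) xp≡2)

    W-23 : ∀ n (y : Vector ℕ n) → (∀ i → y i ≡ 2 ⊎ y i ≡ 3) → 2 ≤ count (3 ≤ᵇ_) y →
      W n y ≡ w (count (3 ≤ᵇ_) y) (Vec.replicate (count (3 ≤ᵇ_) y) 3)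
    W-23 n y y∈ 2≤# with any? (λ i → y i ≟ 2)
    W-23 n y y∈ 2≤# | no no2 = subst (λ c → W n y ≡ w c (Vec.replicate c 3)) (sym #≡n)
      (cong (w n) (trans (Vec.tabulate-cong y≡3) (toVec-const n 3)))
      where
      y≡3 : ∀ i → y i ≡ 3
      y≡3 i with y∈ i
      ... | inj₁ yi≡2 = ⊥-elim (no2 (i , yi≡2))
      ... | inj₂ yi≡3 = yi≡3
      #≡n : count (3 ≤ᵇ_) y ≡ n
      #≡n = count-all (3 ≤ᵇ_) y (λ i → ≤⇒≤ᵇ (≤-reflexive (sym (y≡3 i))))
    W-23 zero    y y∈ 2≤# | yes (() , _)
    W-23 (suc m) y y∈ 2≤# | yes (p , yp≡2) = begin
      W (suc m) y                                            ≡⟨ W-removeAt-2 2≤m y y≥2 p yp≡2 ⟩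
      W m (removeAt y p)                                     ≡⟨ W-23 m (removeAt y p) (y∈ ∘ punchIn p) (subst (2 ≤_) #≡ 2≤#) ⟩
      w (count (3 ≤ᵇ_) (removeAt y p)) (Vec.replicate _ 3)   ≡⟨ cong (λ c → w c (Vec.replicate c 3)) #≡ ⟨
      w (count (3 ≤ᵇ_) y) (Vec.replicate (count (3 ≤ᵇ_) y) 3) ∎
      where
      open ≡-Reasoning
      #≡ : count (3 ≤ᵇ_) y ≡ count (3 ≤ᵇ_) (removeAt y p)
      #≡ = trans (sum-remove {i = p} (𝟙 ∘ (3 ≤ᵇ_) ∘ y)) (cong (λ a → 𝟙 (3 ≤ᵇ a) + count (3 ≤ᵇ_) (removeAt y p)) yp≡2)
      2≤m : 2 ≤ m
      2≤m = ≤-trans (subst (2 ≤_) #≡ 2≤#) (count≤n (3 ≤ᵇ_) (removeAt y p))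
      y≥2 : ∀ i → 2 ≤ y i
      y≥2 i with y∈ i
      ... | inj₁ yi≡2 = ≤-reflexive (sym yi≡2)
      ... | inj₂ yi≡3 = subst (2 ≤_) (sym yi≡3) (n≤1+n 2)

    -- What the expansion of W at a grid point y keeps for itself: the constant of the step and the
    -- child obtained by lowering the 4, below which no grid point lies.
    endWeight : ∀ {n} → Vector ℕ n → ℕ
    endWeight {n} y = (count (3 ≤ᵇ_) y ∸ 2) + W n (lower4 ∘ y)

    endWeight-respects : ∀ {n} → Respects≗ (endWeight {n})
    endWeight-respects y≗z = cong₂ _+_ (cong (_∸ 2) (count-cong (3 ≤ᵇ_) y≗z)) (W-cong _ (cong lower4 ∘ y≗z))

    gridPart : ∀ {n} → Vector ℕ n → ℕ
    gridPart {n} x = ∑Grid 1 n (λ y → pathsBetween x y * endWeight y)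

    gridPart-step : ∀ {n} (x : Vector ℕ n) → gridPart x ≤ 𝟙 (inGrid 1 x) * endWeight x + sum (λ i → 𝟙 (3 ≤ᵇ x i) * gridPart (down x i))
    gridPart-step {n} x = begin
      ∑Grid 1 n (λ y → P x y * ω y)
        ≤⟨ ∑Grid-mono 1 n (λ y y∈ → *-monoˡ-≤ (ω y) (pathsBetween-step x y (Is234⇒2≤ ∘ proj₁ (inGrid-sound 1 y y∈)))) ⟩
      ∑Grid 1 n (λ y → (δ x y + S y) * ω y)
        ≡⟨ ∑Grid-cong 1 n expand ⟩
      ∑Grid 1 n (λ y → δ x y * ω y + sum (λ i → 𝟙 (3 ≤ᵇ x i) * (P (down x i) y * ω y)))
        ≡⟨ ∑Grid-+ 1 n (λ y → δ x y * ω y) (λ y → sum (λ i → 𝟙 (3 ≤ᵇ x i) * (P (down x i) y * ω y))) ⟩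
      ∑Grid 1 n (λ y → δ x y * ω y) + ∑Grid 1 n (λ y → sum (λ i → 𝟙 (3 ≤ᵇ x i) * (P (down x i) y * ω y)))
        ≡⟨ cong₂ _+_ (∑Grid-δ 1 n x ω endWeight-respects)
                     (trans (∑Grid-∑ 1 n (λ i y → 𝟙 (3 ≤ᵇ x i) * (P (down x i) y * ω y)))
                            (sum-cong-≗ (λ i → ∑Grid-*ˡ 1 n (𝟙 (3 ≤ᵇ x i)) (λ y → P (down x i) y * ω y)))) ⟩
      𝟙 (inGrid 1 x) * ω x + sum (λ i → 𝟙 (3 ≤ᵇ x i) * gridPart (down x i)) ∎
      where
      open ≤-Reasoning
      P = pathsBetween
      ω = endWeight
      S : Vector ℕ n → ℕ
      S y = sum (λ i → 𝟙 (3 ≤ᵇ x i) * P (down x i) y)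
      expand : ∀ y → (δ x y + S y) * ω y ≡ δ x y * ω y + sum (λ i → 𝟙 (3 ≤ᵇ x i) * (P (down x i) y * ω y))
      expand y = trans (*-distribʳ-+ (ω y) (δ x y) (S y))
        (cong (δ x y * ω y +_) (trans (*-distribʳ-sum (ω y) (λ i → 𝟙 (3 ≤ᵇ x i) * P (down x i) y))
                                      (sum-cong-≗ (λ i → *-assoc (𝟙 (3 ≤ᵇ x i)) (P (down x i) y) (ω y)))))

    gridPart-vanish : ∀ {n} (z : Vector ℕ n) → (∀ j → z j ≤ 3) → gridPart z ≡ 0
    gridPart-vanish {n} z z≤3 = n≤0⇒n≡0 (≤-trans (∑Grid-mono 1 n {G = λ _ → 0} term) (≤-reflexive (∑Grid-zero 1 n)))
      where
      term : ∀ y → T (inGrid 1 y) → pathsBetween z y * endWeight y ≤ 0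
      term y y∈ = ≤-reflexive (cong (_* endWeight y) (pathsBetween-≰ z y y≰z))
        where
        y≰z : ¬ (∀ i → y i ≤ z i)
        y≰z y≤z = 0≢1+n (trans (sym (count-none (_≡ᵇ 4) y (λ i t → <⇒≱ (s≤s (≤-trans (y≤z i) (z≤3 i)))
                                                                          (≤-reflexive (sym (≡ᵇ⇒≡ (y i) 4 t))))))
                                (proj₂ (inGrid-sound 1 y y∈)))

    gridPart-at-peak : ∀ {n} (x : Vector ℕ n) → T (inGrid 1 x) → ∀ {i} → x i ≡ 4 → gridPart (down x i) ≡ 0
    gridPart-at-peak x x∈ xi≡4 = gridPart-vanish _ (λ j →
      subst (_≤ 3) (sym (inGrid1-down-peak x x∈ xi≡4 j)) (lower4-≤3 (proj₁ (inGrid-sound 1 x x∈) j)))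

    gridPart≤W-step : ∀ {n} → 2 ≤ n → (x : Vector ℕ n) → (∀ i → 2 ≤ x i) →
      (∀ i → 3 ≤ x i → gridPart (down x i) ≤ W n (down x i)) → gridPart x ≤ W n x
    gridPart≤W-step {n} 2≤n x x≥2 below = ≤-trans (gridPart-step x) (bound (inGrid 1 x) refl)
      where
      Σgrid = sum (λ i → 𝟙 (3 ≤ᵇ x i) * gridPart (down x i))
      ΣW = sum (λ i → 𝟙 (3 ≤ᵇ x i) * W n (down x i))
      c = count (3 ≤ᵇ_) x ∸ 2
      active : ∀ i → 𝟙 (3 ≤ᵇ x i) * gridPart (down x i) ≤ 𝟙 (3 ≤ᵇ x i) * W n (down x i)
      active i = 𝟙*-mono (3 ≤ᵇ x i) (below i ∘ ≤ᵇ⇒≤ 3 (x i))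
      bound : ∀ g → inGrid 1 x ≡ g → 𝟙 g * endWeight x + Σgrid ≤ W n x
      bound false _ = ≤-trans (∑-mono-≤ active) (≤-trans (m≤m+n ΣW c) (≤-reflexive (sym (W-step n 2≤n x x≥2))))
      bound true  x∈≡ = begin
        1 * (c + Wl) + Σgrid                    ≡⟨ cong (_+ Σgrid) (*-identityˡ (c + Wl)) ⟩
        c + Wl + Σgrid                          ≡⟨ +-assoc c Wl Σgrid ⟩
        c + (Wl + Σgrid)                        ≡⟨ cong (λ a → c + (a + Σgrid)) Wl≡ ⟩
        c + (sum (λ i → 𝟙 (x i ≡ᵇ 4) * Wl) + Σgrid)
                                                ≡⟨ cong (c +_) (∑-distrib-+ (λ i → 𝟙 (x i ≡ᵇ 4) * Wl) _) ⟨
        c + sum (λ i → 𝟙 (x i ≡ᵇ 4) * Wl + 𝟙 (3 ≤ᵇ x i) * gridPart (down x i))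
                                                ≤⟨ +-monoʳ-≤ c (∑-mono-≤ peak-or-active) ⟩
        c + ΣW                                  ≡⟨ +-comm c ΣW ⟩
        ΣW + c                                  ≡⟨ W-step n 2≤n x x≥2 ⟨
        W n x                                   ∎
        where
        open ≤-Reasoning
        x∈ : T (inGrid 1 x)
        x∈ = subst T (sym x∈≡) _
        Wl = W n (lower4 ∘ x)
        Wl≡ : Wl ≡ sum (λ i → 𝟙 (x i ≡ᵇ 4) * Wl)
        Wl≡ = trans (sym (*-identityˡ Wl)) (trans (cong (_* Wl) (sym (proj₂ (inGrid-sound 1 x x∈))))
                                                  (*-distribʳ-sum Wl (λ i → 𝟙 (x i ≡ᵇ 4))))
        peak-or-active : ∀ i → 𝟙 (x i ≡ᵇ 4) * Wl + 𝟙 (3 ≤ᵇ x i) * gridPart (down x i) ≤ 𝟙 (3 ≤ᵇ x i) * W n (down x i)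
        peak-or-active i with x i ≟ 4
        ... | no xi≢4 = subst (λ a → a * Wl + 𝟙 (3 ≤ᵇ x i) * gridPart (down x i) ≤ 𝟙 (3 ≤ᵇ x i) * W n (down x i))
                              (sym (𝟙-≡ᵇ-≢ xi≢4)) (active i)
        ... | yes xi≡4 = ≤-reflexive (begin-equality
          𝟙 (x i ≡ᵇ 4) * Wl + 𝟙 (3 ≤ᵇ x i) * gridPart (down x i)
            ≡⟨ cong₂ (λ a b → a * Wl + 𝟙 (3 ≤ᵇ x i) * b) (cong (λ a → 𝟙 (a ≡ᵇ 4)) xi≡4) (gridPart-at-peak x x∈ xi≡4) ⟩
          1 * Wl + 𝟙 (3 ≤ᵇ x i) * 0
            ≡⟨ cong₂ _+_ (*-identityˡ Wl) (*-zeroʳ (𝟙 (3 ≤ᵇ x i))) ⟩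
          Wl + 0
            ≡⟨ trans (+-identityʳ Wl) (sym (W-cong n (inGrid1-down-peak x x∈ xi≡4))) ⟩
          W n (down x i)
            ≡⟨ *-identityˡ (W n (down x i)) ⟨
          1 * W n (down x i)
            ≡⟨ cong (_* W n (down x i)) (𝟙-≤ᵇ (≤-trans (n≤1+n 3) (≤-reflexive (sym xi≡4)))) ⟨
          𝟙 (3 ≤ᵇ x i) * W n (down x i) ∎)

    gridPart≤W-below : ∀ {n} → 2 ≤ n → ∀ b (x : Vector ℕ n) → sum x < b → (∀ i → 2 ≤ x i) → gridPart x ≤ W n x
    gridPart≤W-below 2≤n (suc b) x (s≤s ∑x≤b) x≥2 = gridPart≤W-step 2≤n x x≥2 (λ i 3≤xi →
      gridPart≤W-below 2≤n b (down x i) (≤-trans (≤-reflexive (sym (∑-down-≥1 x i (≤-trans (s≤s z≤n) 3≤xi)))) ∑x≤b) (down≥2 x i 3≤xi x≥2))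

    gridPart≤W : ∀ {n} → 2 ≤ n → (x : Vector ℕ n) → (∀ i → 2 ≤ x i) → gridPart x ≤ W n x
    gridPart≤W 2≤n x = gridPart≤W-below 2≤n (suc (sum x)) x ≤-refl

    endWeight-grid1 : ∀ {n} (y : Vector ℕ n) → T (inGrid 1 y) → 2 + count2 y ≤ n →
      endWeight y ≡ (n ∸ count2 y ∸ 2) + w (n ∸ count2 y) (Vec.replicate (n ∸ count2 y) 3)
    endWeight-grid1 {n} y y∈ fits =
      cong₂ _+_ (cong (_∸ 2) (grid1-count≥3 y y∈))
                (trans (W-23 n (lower4 ∘ y) (lower4-23 ∘ coords) (subst (2 ≤_) (sym #lower) 2≤n-j))
                       (cong (λ c → w c (Vec.replicate c 3)) #lower))
      where
      coords = proj₁ (inGrid-sound 1 y y∈)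
      #lower : count (3 ≤ᵇ_) (lower4 ∘ y) ≡ n ∸ count2 y
      #lower = trans (sum-cong-≗ (λ i → cong 𝟙 (Is234-3≤ᵇ-lower4 (coords i)))) (grid1-count≥3 y y∈)
      2≤n-j : 2 ≤ n ∸ count2 y
      2≤n-j = m+n≤o⇒m≤o∸n 2 fits

    W∸gridPart-super : ∀ {n} → 2 ≤ n → ∀ x → (∀ i → 3 ≤ x i) → 2 ≤ count (4 ≤ᵇ_) x →
      sum (λ i → W n (down x i) ∸ gridPart (down x i)) + (n ∸ 2) ≤ W n x ∸ gridPart x
    W∸gridPart-super {n} 2≤n x x≥3 2≤#4 = begin
      sum (λ i → W n (down x i) ∸ gridPart (down x i)) + (n ∸ 2)
        ≡⟨ cong (_+ (n ∸ 2)) (∑-∸ (λ i → W n (down x i)) (λ i → gridPart (down x i)) below) ⟩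
      ΣW ∸ Σgrid + (n ∸ 2)      ≡⟨ +-∸-comm (n ∸ 2) (∑-mono-≤ below) ⟨
      ΣW + (n ∸ 2) ∸ Σgrid      ≡⟨ cong (_∸ Σgrid) (W-rec 2≤n x x≥3) ⟨
      W n x ∸ Σgrid             ≤⟨ ∸-monoʳ-≤ (W n x) gridPart≤Σ ⟩
      W n x ∸ gridPart x        ∎
      where
      open ≤-Reasoning
      ΣW = sum (λ i → W n (down x i))
      Σgrid = sum (λ i → gridPart (down x i))
      x≥2 : ∀ i → 2 ≤ x i
      x≥2 i = ≤-trans (n≤1+n 2) (x≥3 i)
      below : ∀ i → gridPart (down x i) ≤ W n (down x i)
      below i = gridPart≤W 2≤n (down x i) (down≥2 x i (x≥3 i) x≥2)
      x∉ : 𝟙 (inGrid 1 x) ≡ 0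
      x∉ = 𝟙-¬T (λ x∈ → <⇒≱ (s≤s (s≤s z≤n)) (≤-trans 2≤#4 (≤-reflexive (grid1-count≥4 x x∈))))
      gridPart≤Σ : gridPart x ≤ Σgrid
      gridPart≤Σ = ≤-trans (gridPart-step x) (≤-reflexive
        (trans (cong (λ a → a * endWeight x + sum (λ i → 𝟙 (3 ≤ᵇ x i) * gridPart (down x i))) x∉)
               (sum-cong-≗ (λ i → trans (cong (_* gridPart (down x i)) (𝟙-≤ᵇ (x≥3 i))) (*-identityˡ _)))))

    staircase+gridPart≤W : ∀ r → 2 ≤ r → ∀ k → 4 ≤ k →
      staircase r (r ∸ 2) (k ∸ 4) + gridPart (λ (_ : Fin r) → k) ≤ W r (λ _ → k)
    staircase+gridPart≤W r 2≤r k 4≤k = begin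
      staircase r (r ∸ 2) (k ∸ 4) + gridPart top     ≤⟨ +-monoˡ-≤ (gridPart top) (staircase-bound (k ∸ 4) top (λ _ → sym (m+[n∸m]≡n 4≤k))) ⟩
      W r top ∸ gridPart top + gridPart top          ≡⟨ m∸n+n≡m (gridPart≤W 2≤r top (λ _ → ≤-trans (s≤s (s≤s z≤n)) 4≤k)) ⟩
      W r top                                        ∎
      where
      open ≤-Reasoning
      open StaircaseBound 2≤r (r ∸ 2) (λ x → W r x ∸ gridPart x) (W∸gridPart-super 2≤r)
      top = λ (_ : Fin r) → k

    gridTerm : ℕ → ℕ → ℕ → ℕ
    gridTerm r k j = (r C j) * gridPaths r k j * (r ∸ j) * ((r ∸ j ∸ 2) + w (r ∸ j) (Vec.replicate (r ∸ j) 3))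

    gridPart-lower : ∀ r k → 2 ≤ r → 4 ≤ k → ∑ℕ (r ∸ 2) (gridTerm r k) ≤ gridPart (λ (_ : Fin r) → k)
    gridPart-lower r k 2≤r 4≤k = begin
      ∑ℕ (r ∸ 2) (gridTerm r k)                  ≤⟨ ∑ℕ-mono-prefix (gridTerm r k) _ (≤-trans (m∸n≤m r 2) (n≤1+n r)) term≤ ⟩
      ∑ℕ (suc r) (λ j → (r C j) * (r ∸ j) * h j) ≡⟨ ∑Grid-1-count2 r h ⟨
      ∑Grid 1 r (h ∘ count2)                     ≤⟨ ∑Grid-mono 1 r point ⟩
      gridPart (λ (_ : Fin r) → k)               ∎
      where
      open ≤-Reasoning
      M = gridPaths r k
      val : ℕ → ℕ
      val j = (r ∸ j ∸ 2) + w (r ∸ j) (Vec.replicate (r ∸ j) 3)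
      -- Cut off at j < r − 2: beyond that a grid point has too few threes for W-23.
      h : ℕ → ℕ
      h j = 𝟙 (suc j ≤ᵇ r ∸ 2) * (M j * val j)
      rearrange : ∀ a b c d → a * b * c * d ≡ a * c * (b * d)
      rearrange = solve-∀
      term≤ : ∀ j → j < r ∸ 2 → gridTerm r k j ≤ (r C j) * (r ∸ j) * h j
      term≤ j j<r-2 = ≤-reflexive (trans (rearrange (r C j) (M j) (r ∸ j) (val j))
        (cong ((r C j) * (r ∸ j) *_) (sym (trans (cong (_* (M j * val j)) (𝟙-≤ᵇ j<r-2)) (*-identityˡ (M j * val j))))))
      point : ∀ y → T (inGrid 1 y) → h (count2 y) ≤ pathsBetween (λ _ → k) y * endWeight y
      point y y∈ = 𝟙*-bound (suc (count2 y) ≤ᵇ r ∸ 2) (λ t → ≤-reflexive (sym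
        (cong₂ _*_ (pathsBetween-grid1 k 4≤k y y∈) (endWeight-grid1 y y∈ (fits (≤ᵇ⇒≤ _ _ t))))))
        where
        fits : count2 y < r ∸ 2 → 2 + count2 y ≤ r
        fits j<r-2 = ≤-trans (≤-reflexive (+-comm 2 (count2 y)))
                             (≤-trans (+-monoˡ-≤ 2 (<⇒≤ j<r-2)) (≤-reflexive (m∸n+n≡m 2≤r)))

    main-bound : ∀ r k → 2 ≤ r → 4 ≤ k → staircase r (r ∸ 2) (k ∸ 4) + ∑ℕ (r ∸ 2) (gridTerm r k) ≤ w r (Vec.replicate r k)
    main-bound r k 2≤r 4≤k = ≤-trans (+-monoʳ-≤ (staircase r (r ∸ 2) (k ∸ 4)) (gridPart-lower r k 2≤r 4≤k))
      (≤-trans (staircase+gridPart≤W r 2≤r k 4≤k) (≤-reflexive (cong (w r) (toVec-const r k))))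

module RationalForm where

  open import Data.Nat as ℕ using (ℕ; zero; suc; _!; _∸_; _^_)
  import Data.Nat.Properties as ℕ
  import Data.Integer as ℤ
  import Data.Integer.Properties as ℤ
  open import Data.Rational
  open import Data.Rational.Properties
  open import Data.Rational.Solver using (module +-*-Solver)
  open import Data.Nat.Coprimality using (1-coprimeTo)
  import Data.Nat.Coprimality as Coprime
  open import Data.List using (foldr; map; applyUpTo)
  open import Function using (_∘_)
  open import Relation.Binary.PropositionalEquality
  open import Data.Nat.Tactic.RingSolver using (solve-∀)
  open Counting using (H; geom; ^≡geom; staircase; staircase-closed; ∑ℕ)

  ℕ→ℚ-normal : ∀ n → ℕ→ℚ n ≡ mkℚ (ℤ.+ n) 0 (Coprime.sym (1-coprimeTo n))
  ℕ→ℚ-normal n = normalize-coprime (Coprime.sym (1-coprimeTo n))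

  ℕ→ℚ-+ : ∀ a b → ℕ→ℚ (a ℕ.+ b) ≡ ℕ→ℚ a + ℕ→ℚ b
  ℕ→ℚ-+ a b = sym (trans (cong₂ _+_ (ℕ→ℚ-normal a) (ℕ→ℚ-normal b))
    (/-cong (cong₂ ℤ._+_ (ℤ.*-identityʳ (ℤ.+ a)) (ℤ.*-identityʳ (ℤ.+ b))) refl))

  ℕ→ℚ-* : ∀ a b → ℕ→ℚ (a ℕ.* b) ≡ ℕ→ℚ a * ℕ→ℚ b
  ℕ→ℚ-* a b = sym (trans (cong₂ _*_ (ℕ→ℚ-normal a) (ℕ→ℚ-normal b)) (/-cong (sym (ℤ.pos-* a b)) refl))

  ℕ→ℚ-mono-≤ : ∀ {a b} → a ℕ.≤ b → ℕ→ℚ a ≤ ℕ→ℚ b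
  ℕ→ℚ-mono-≤ {a} {b} a≤b = subst₂ _≤_ (sym (ℕ→ℚ-normal a)) (sym (ℕ→ℚ-normal b))
    (*≤* (subst₂ ℤ._≤_ (sym (ℤ.*-identityʳ (ℤ.+ a))) (sym (ℤ.*-identityʳ (ℤ.+ b))) (ℤ.+≤+ a≤b)))

  ℕ→ℚ-*-1/ : ∀ d → ℕ→ℚ (suc d) * (ℤ.+ 1 / suc d) ≡ 1ℚ
  ℕ→ℚ-*-1/ d = trans (cong₂ _*_ (ℕ→ℚ-normal (suc d)) (normalize-coprime (1-coprimeTo (suc d))))
                      (*-inverseʳ (mkℚ (ℤ.+ suc d) 0 (Coprime.sym (1-coprimeTo (suc d)))))

  *-÷ℕ-cancel : ∀ x d → (x * ℕ→ℚ (suc d)) ÷ℕ suc d ≡ x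
  *-÷ℕ-cancel x d = trans (*-assoc x (ℕ→ℚ (suc d)) (ℤ.+ 1 / suc d)) (trans (cong (x *_) (ℕ→ℚ-*-1/ d)) (*-identityʳ x))

  1/!*! : ∀ n → (1ℚ ÷ℕ (n !)) * ℕ→ℚ (n !) ≡ 1ℚ
  1/!*! n with n ! | ℕ.1≤n! n
  ... | suc d | _ = trans (cong (_* ℕ→ℚ (suc d)) (*-identityˡ (ℤ.+ 1 / suc d)))
                          (trans (*-comm (ℤ.+ 1 / suc d) (ℕ→ℚ (suc d))) (ℕ→ℚ-*-1/ d))

  foldr-applyUpTo-suc : ∀ n (f : ℕ → ℚ) (h : ℕ → ℕ) →
    foldr _+_ 0ℚ (map f (applyUpTo h (suc n))) ≡ foldr _+_ 0ℚ (map f (applyUpTo h n)) + f (h n)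
  foldr-applyUpTo-suc zero    f h = trans (+-identityʳ (f (h 0))) (sym (+-identityˡ (f (h 0))))
  foldr-applyUpTo-suc (suc n) f h = trans (cong (f (h 0) +_) (foldr-applyUpTo-suc n f (h ∘ suc))) (sym (+-assoc (f (h 0)) _ _))

  e*! : ∀ r → e r * ℕ→ℚ (r !) ≡ ℕ→ℚ (H r ℕ.+ r !)
  e*! zero    = refl
  e*! (suc r) = begin
    e (suc r) * ℕ→ℚ (suc r !)
      ≡⟨ cong (_* ℕ→ℚ (suc r !)) (foldr-applyUpTo-suc (suc r) (λ n → 1ℚ ÷ℕ (n !)) (λ n → n)) ⟩
    (e r + 1ℚ ÷ℕ (suc r !)) * ℕ→ℚ (suc r !)
      ≡⟨ *-distribʳ-+ (ℕ→ℚ (suc r !)) (e r) _ ⟩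
    e r * ℕ→ℚ (suc r !) + (1ℚ ÷ℕ (suc r !)) * ℕ→ℚ (suc r !)
      ≡⟨ cong₂ _+_ e*[1+r]! (1/!*! (suc r)) ⟩
    ℕ→ℚ ((H r ℕ.+ r !) ℕ.* suc r) + ℕ→ℚ 1
      ≡⟨ ℕ→ℚ-+ ((H r ℕ.+ r !) ℕ.* suc r) 1 ⟨
    ℕ→ℚ ((H r ℕ.+ r !) ℕ.* suc r ℕ.+ 1)
      ≡⟨ cong ℕ→ℚ (rearrange r (H r) (r !)) ⟩
    ℕ→ℚ (H (suc r) ℕ.+ suc r !) ∎
    where
    open ≡-Reasoning
    rearrange : ∀ r h f → (h ℕ.+ f) ℕ.* suc r ℕ.+ 1 ≡ suc r ℕ.* h ℕ.+ 1 ℕ.+ suc r ℕ.* f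
    rearrange = solve-∀
    e*[1+r]! : e r * ℕ→ℚ (suc r !) ≡ ℕ→ℚ ((H r ℕ.+ r !) ℕ.* suc r)
    e*[1+r]! = begin
      e r * ℕ→ℚ (suc r !)                   ≡⟨ cong (e r *_) (trans (ℕ→ℚ-* (suc r) (r !)) (*-comm (ℕ→ℚ (suc r)) (ℕ→ℚ (r !)))) ⟩
      e r * (ℕ→ℚ (r !) * ℕ→ℚ (suc r))       ≡⟨ *-assoc (e r) (ℕ→ℚ (r !)) (ℕ→ℚ (suc r)) ⟨
      e r * ℕ→ℚ (r !) * ℕ→ℚ (suc r)         ≡⟨ cong (_* ℕ→ℚ (suc r)) (e*! r) ⟩
      ℕ→ℚ (H r ℕ.+ r !) * ℕ→ℚ (suc r)       ≡⟨ ℕ→ℚ-* (H r ℕ.+ r !) (suc r) ⟨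
      ℕ→ℚ ((H r ℕ.+ r !) ℕ.* suc r)         ∎

  geom-quotient : ∀ N m → 2 ℕ.≤ N → (ℕ→ℚ (N ^ m) - 1ℚ) ÷ℕ (N ∸ 1) ≡ ℕ→ℚ (geom N m)
  geom-quotient zero          m ()
  geom-quotient (suc zero)    m (ℕ.s≤s ())
  geom-quotient (suc (suc d)) m _ = begin
    (ℕ→ℚ (N ^ m) - 1ℚ) ÷ℕ suc d                              ≡⟨ cong (λ z → (ℕ→ℚ z - 1ℚ) ÷ℕ suc d) (^≡geom N m (ℕ.s≤s ℕ.z≤n)) ⟩
    (ℕ→ℚ (suc d ℕ.* geom N m ℕ.+ 1) - 1ℚ) ÷ℕ suc d           ≡⟨ cong (λ z → (z - 1ℚ) ÷ℕ suc d)
                                                                 (trans (ℕ→ℚ-+ (suc d ℕ.* geom N m) 1) (cong (_+ 1ℚ) (ℕ→ℚ-* (suc d) (geom N m)))) ⟩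
    (ℕ→ℚ (suc d) * ℕ→ℚ (geom N m) + 1ℚ - 1ℚ) ÷ℕ suc d       ≡⟨ cong (_÷ℕ suc d) (solve 2 (λ x y → x :* y :+ con 1ℚ :- con 1ℚ := y :* x)
                                                                                          refl (ℕ→ℚ (suc d)) (ℕ→ℚ (geom N m))) ⟩
    (ℕ→ℚ (geom N m) * ℕ→ℚ (suc d)) ÷ℕ suc d                 ≡⟨ *-÷ℕ-cancel (ℕ→ℚ (geom N m)) d ⟩
    ℕ→ℚ (geom N m)                                           ∎
    where
    open ≡-Reasoning
    open +-*-Solver
    N = suc (suc d)

  2≤n! : ∀ {n} → 2 ℕ.≤ n → 2 ℕ.≤ n !
  2≤n! {suc m} (ℕ.s≤s 1≤m) =
    ℕ.≤-trans (ℕ.s≤s 1≤m) (ℕ.≤-trans (ℕ.≤-reflexive (sym (ℕ.*-identityʳ (suc m)))) (ℕ.*-monoʳ-≤ (suc m) (ℕ.1≤n! m)))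

  staircase-ℚ : ∀ r k → 2 ℕ.≤ r → 4 ℕ.≤ k →
    ℕ→ℚ (r ∸ 2) * ℕ→ℚ (r !) * ((e r - 1ℚ) * ((ℕ→ℚ ((r !) ^ (k ∸ 3)) - 1ℚ) ÷ℕ ((r !) ∸ 1)) - ℕ→ℚ ((r !) ^ (k ∸ 4)))
    ≡ ℕ→ℚ (staircase r (r ∸ 2) (k ∸ 4))
  staircase-ℚ r k 2≤r 4≤k = begin
    a * N * ((e r - 1ℚ) * ((ℕ→ℚ ((r !) ^ (k ∸ 3)) - 1ℚ) ÷ℕ ((r !) ∸ 1)) - P)
      ≡⟨ cong (λ z → a * N * ((e r - 1ℚ) * z - P)) (geom-quotient (r !) (k ∸ 3) (2≤n! 2≤r)) ⟩
    a * N * ((e r - 1ℚ) * G - P)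
      ≡⟨ solve 5 (λ a n x g p → a :* n :* ((x :- con 1ℚ) :* g :- p) := a :* ((x :* n) :* g :- n :* g :- n :* p)) refl a N (e r) G P ⟩
    a * (e r * N * G - N * G - N * P)
      ≡⟨ cong (λ z → a * (z * G - N * G - N * P)) (trans (e*! r) (ℕ→ℚ-+ (H r) (r !))) ⟩
    a * ((ℕ→ℚ (H r) + N) * G - N * G - N * P)
      ≡⟨ solve 5 (λ a h n g p → a :* ((h :+ n) :* g :- n :* g :- n :* p) := a :* h :* g :- a :* (n :* p)) refl a (ℕ→ℚ (H r)) N G P ⟩
    a * ℕ→ℚ (H r) * G - a * (N * P)
      ≡⟨ cong (_- a * (N * P)) closed ⟨
    ℕ→ℚ (staircase r (r ∸ 2) u) + a * (N * P) - a * (N * P)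
      ≡⟨ solve 2 (λ s x → s :+ x :- x := s) refl (ℕ→ℚ (staircase r (r ∸ 2) u)) (a * (N * P)) ⟩
    ℕ→ℚ (staircase r (r ∸ 2) u) ∎
    where
    open ≡-Reasoning
    open +-*-Solver
    u = k ∸ 4
    a = ℕ→ℚ (r ∸ 2)
    N = ℕ→ℚ (r !)
    G = ℕ→ℚ (geom (r !) (k ∸ 3))
    P = ℕ→ℚ ((r !) ^ u)
    k∸3≡ : ∀ {k} → 4 ℕ.≤ k → k ∸ 3 ≡ suc (k ∸ 4)
    k∸3≡ (ℕ.s≤s (ℕ.s≤s (ℕ.s≤s (ℕ.s≤s _)))) = refl
    closed : ℕ→ℚ (staircase r (r ∸ 2) u) + a * (N * P) ≡ a * ℕ→ℚ (H r) * G
    closed = begin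
      ℕ→ℚ (staircase r (r ∸ 2) u) + a * (N * P)
        ≡⟨ cong (ℕ→ℚ (staircase r (r ∸ 2) u) +_) (trans (cong (a *_) (sym (ℕ→ℚ-* (r !) ((r !) ^ u)))) (sym (ℕ→ℚ-* (r ∸ 2) ((r !) ℕ.* (r !) ^ u)))) ⟩
      ℕ→ℚ (staircase r (r ∸ 2) u) + ℕ→ℚ ((r ∸ 2) ℕ.* (r ! ℕ.* (r !) ^ u))
        ≡⟨ ℕ→ℚ-+ (staircase r (r ∸ 2) u) ((r ∸ 2) ℕ.* (r !) ^ suc u) ⟨
      ℕ→ℚ (staircase r (r ∸ 2) u ℕ.+ (r ∸ 2) ℕ.* (r !) ^ suc u)
        ≡⟨ cong ℕ→ℚ (staircase-closed r (r ∸ 2) u (ℕ.≤-trans (ℕ.s≤s ℕ.z≤n) 2≤r)) ⟩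
      ℕ→ℚ ((r ∸ 2) ℕ.* H r ℕ.* geom (r !) (suc u))
        ≡⟨ trans (ℕ→ℚ-* ((r ∸ 2) ℕ.* H r) (geom (r !) (suc u))) (cong₂ _*_ (ℕ→ℚ-* (r ∸ 2) (H r)) (cong (ℕ→ℚ ∘ geom (r !)) (sym (k∸3≡ 4≤k)))) ⟩
      a * ℕ→ℚ (H r) * G ∎

  Σℚ[<]-ℕ→ℚ : ∀ n {f : ℕ → ℚ} {F : ℕ → ℕ} → (∀ j → f j ≡ ℕ→ℚ (F j)) → Σℚ[< n ] f ≡ ℕ→ℚ (∑ℕ n F)
  Σℚ[<]-ℕ→ℚ n {f} {F} f≡ = go n (λ j → j)
    where
    go : ∀ n (h : ℕ → ℕ) → foldr _+_ 0ℚ (map f (applyUpTo h n)) ≡ ℕ→ℚ (∑ℕ n (F ∘ h))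
    go zero    h = refl
    go (suc n) h = trans (cong₂ _+_ (f≡ (h 0)) (go n (h ∘ suc))) (sym (ℕ→ℚ-+ (F (h 0)) _))

  ℕ→ℚ-*-*-*-+ : ∀ a b c d e → ℕ→ℚ a * ℕ→ℚ b * ℕ→ℚ c * (ℕ→ℚ d + ℕ→ℚ e) ≡ ℕ→ℚ (a ℕ.* b ℕ.* c ℕ.* (d ℕ.+ e))
  ℕ→ℚ-*-*-*-+ a b c d e = sym (begin
    ℕ→ℚ (a ℕ.* b ℕ.* c ℕ.* (d ℕ.+ e))               ≡⟨ ℕ→ℚ-* (a ℕ.* b ℕ.* c) (d ℕ.+ e) ⟩
    ℕ→ℚ (a ℕ.* b ℕ.* c) * ℕ→ℚ (d ℕ.+ e)             ≡⟨ cong₂ _*_ (trans (ℕ→ℚ-* (a ℕ.* b) c) (cong (_* ℕ→ℚ c) (ℕ→ℚ-* a b)))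
                                                                 (ℕ→ℚ-+ d e) ⟩
    ℕ→ℚ a * ℕ→ℚ b * ℕ→ℚ c * (ℕ→ℚ d + ℕ→ℚ e)         ∎)
    where open ≡-Reasoning

open import Data.Nat using (ℕ; suc; _∸_; _^_)
import Data.Nat
open import Data.Nat using (_!)
open import Data.Nat.Combinatorics using (_C_)
open import Data.Vec using (Vec; replicate)
open import Data.List using (List; _∷_; []; _++_)
import Data.List as List
open import Data.Rational using (ℚ; _≤_; _*_; _+_; _-_; 1ℚ)
open import Data.Rational.Properties using (≤-trans; ≤-reflexive)
open import Relation.Binary.PropositionalEquality using (_≡_; sym; trans; cong₂)
open Counting using (∑ℕ; staircase; gridPaths)
open RationalForm using (ℕ→ℚ-+; ℕ→ℚ-mono-≤; staircase-ℚ; Σℚ[<]-ℕ→ℚ; ℕ→ℚ-*-*-*-+)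

theorem3p7 : (w : (r : ℕ) → Vec ℕ r → ℕ) → IsW w →
  ∀ r k → 2 Data.Nat.≤ r → 4 Data.Nat.≤ k →
  (ℕ→ℚ (r ∸ 2) * ℕ→ℚ (r !) * ((e r - 1ℚ) * ((ℕ→ℚ ((r !) ^ (k ∸ 3)) - 1ℚ) ÷ℕ ((r !) ∸ 1)) - ℕ→ℚ ((r !) ^ (k ∸ 4))))
  + Σℚ[< r ∸ 2 ] (λ j →
      ℕ→ℚ (r C j)
      * ℕ→ℚ (multinomial ((r Data.Nat.* (k ∸ 3)) Data.Nat.+ j ∸ 1)
               (List.replicate j (k ∸ 2) ++ List.replicate (r ∸ j ∸ 1) (k ∸ 3) ++ (k ∸ 4 ∷ [])))
      * ℕ→ℚ (r ∸ j)
      * (ℕ→ℚ (r ∸ j ∸ 2) + ℕ→ℚ (w (r ∸ j) (replicate (r ∸ j) 3))))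
  ≤ ℕ→ℚ (w r (replicate r k))
theorem3p7 w isW r k 2≤r 4≤k = ≤-trans
  (≤-reflexive (trans (cong₂ _+_ (staircase-ℚ r k 2≤r 4≤k) (Σℚ[<]-ℕ→ℚ (r ∸ 2) term≡)) (sym (ℕ→ℚ-+ σ Σ))))
  (ℕ→ℚ-mono-≤ (main-bound r k 2≤r 4≤k))
  where
  open Counting.WithRecursion w isW using (gridTerm; main-bound)
  σ = staircase r (r ∸ 2) (k ∸ 4)
  Σ = ∑ℕ (r ∸ 2) (gridTerm r k)
  term≡ : ∀ j → _ ≡ ℕ→ℚ (gridTerm r k j)
  term≡ j = ℕ→ℚ-*-*-*-+ (r C j) (gridPaths r k j) (r ∸ j) (r ∸ j ∸ 2) (w (r ∸ j) (replicate (r ∸ j) 3))
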